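{- The poset $N_{1,1,c}$ is LE-symmetric for all integers $c\ge1$, and the poset $N_{a,1,1}$ is LE-symmetric for all integers $a\ge1$.
   Context: For integers $a,b,c\ge1$, $N_{a,b,c}$ is the poset on elements $v_1,\dots,v_{a+b+c+1}$ whose order is generated by the relations $v_1<v_2<\dots<v_{a+1}>v_{a+2}>\dots>v_{a+b+1}<v_{a+b+2}<\dots<v_{a+b+c+1}$. For an $n$-element poset $P$, a linear extension is a list $(p_1,\dots,p_n)$ of all elements with $p_a<_P p_b$ implying $a<b$; ${\mathcal{L}}(P)$ is the set of these. The Bender--Knuth move $t_i$ ($1\le i\le n-1$) acts on ${\mathcal{L}}(P)$ by swapping $p_i,p_{i+1}$ if incomparable and fixing the list otherwise; $\mathcal{BK}_P\le{\mathfrak{S}}_{{\mathcal{L}}(P)}$ is the group they generate. $P$ is LE-symmetric if $\mathcal{BK}_P={\mathfrak{S}}_{{\mathcal{L}}(P)}$. -}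

module Defs where

open import Data.Nat using (ℕ; zero; suc; _+_)
import Data.Nat as ℕ
open import Data.Bool using (Bool; true; false; _∧_; _∨_; if_then_else_; T)
open import Data.Fin using (Fin; toℕ; inject₁) renaming (suc to fsuc; _<_ to _<ᶠ_)
open import Data.Fin.Properties using (_≟_)
open import Data.Vec using (Vec; lookup; _[_]≔_)
open import Data.Vec.Membership.Propositional using (_∈_)
open import Data.List using (List; []; _∷_)
open import Data.Bool.ListAction using (any)
open import Data.Fin using (Fin)
import Data.List as List
open import Relation.Nullary.Decidable using (⌊_⌋)
open import Relation.Binary.PropositionalEquality using (_≡_)
open import Data.Product using (Σ; ∃)
open import Function.Bundles using (Inverse)
open import Relation.Binary.Bundles using (Setoid)
open import Relation.Binary.PropositionalEquality using (setoid)
import Relation.Binary.Construct.On as On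
open import Level using (0ℓ)

allF : (n : ℕ) → List (Fin n)
allF n = List.allFin n

_==ᴺ_ : ℕ → ℕ → Bool
m ==ᴺ n = ⌊ m ℕ.≟ n ⌋

_<ᴺ_ : ℕ → ℕ → Bool
m <ᴺ n = ⌊ m ℕ.<? n ⌋

_≤ᴺ_ : ℕ → ℕ → Bool
m ≤ᴺ n = ⌊ m ℕ.≤? n ⌋

-- The poset N_{a,b,c} lives on Fin (a+b+c+1); element k (0-based) is v_{k+1}.
Size : ℕ → ℕ → ℕ → ℕ
Size a b c = suc (a + b + c)

-- Generating (covering) relations: cover a b c x y = true iff "x < y" is one
-- of the generating relations
--   v_1<v_2<...<v_{a+1} > v_{a+2} > ... > v_{a+b+1} < ... < v_{a+b+c+1}.
cover : (a b c : ℕ) → Fin (Size a b c) → Fin (Size a b c) → Bool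
cover a b c x y =
     ((toℕ y ==ᴺ suc (toℕ x)) ∧ (toℕ x <ᴺ a))
  ∨ ((toℕ x ==ᴺ suc (toℕ y)) ∧ ((a ≤ᴺ toℕ y) ∧ (toℕ y <ᴺ (a + b))))
  ∨ ((toℕ y ==ᴺ suc (toℕ x)) ∧ (((a + b) ≤ᴺ toℕ x) ∧ (toℕ x <ᴺ (a + b + c))))

reach : {n : ℕ} → (Fin n → Fin n → Bool) → ℕ → Fin n → Fin n → Bool
reach R zero    x y = false
reach {n} R (suc k) x y =
  any (λ z → R x z ∧ (⌊ z ≟ y ⌋ ∨ reach R k z y)) (allF n)

-- Strict order of a poset generated by R on an n-element set: the transitive
-- closure, computed with paths of length at most n (which suffices).
genLt : {n : ℕ} → (Fin n → Fin n → Bool) → Fin n → Fin n → Bool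
genLt {n} R = reach R n

ltN : (a b c : ℕ) → Fin (Size a b c) → Fin (Size a b c) → Bool
ltN a b c = genLt (cover a b c)

comparableN : (a b c : ℕ) → Fin (Size a b c) → Fin (Size a b c) → Bool
comparableN a b c x y = ltN a b c x y ∨ ltN a b c y x

record LinExt (a b c : ℕ) : Set where
  field
    list  : Vec (Fin (Size a b c)) (Size a b c)
    all   : ∀ x → x ∈ list
    order : ∀ i j → T (ltN a b c (lookup list i) (lookup list j)) → i <ᶠ j
open LinExt public

LESetoid : (a b c : ℕ) → Setoid 0ℓ 0ℓ
LESetoid a b c = On.setoid {B = LinExt a b c} (setoid (Vec (Fin (Size a b c)) (Size a b c))) list

-- Bender–Knuth move t_i, i ∈ {1,..,n-1} indexed by Fin (a+b+c) (i ↦ positions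
-- inject₁ i, fsuc i, i.e. p_i and p_{i+1}); acts on lists: swap the two
-- entries if incomparable, else fix.
bk : (a b c : ℕ) → Fin (a + b + c) →
     Vec (Fin (Size a b c)) (Size a b c) → Vec (Fin (Size a b c)) (Size a b c)
bk a b c i p =
  let x = lookup p (inject₁ i)
      y = lookup p (fsuc i)
  in if comparableN a b c x y then p
     else ((p [ inject₁ i ]≔ y) [ fsuc i ]≔ x)

bkWord : (a b c : ℕ) → List (Fin (a + b + c)) →
         Vec (Fin (Size a b c)) (Size a b c) → Vec (Fin (Size a b c)) (Size a b c)
bkWord a b c []       p = p
bkWord a b c (i ∷ w)  p = bk a b c i (bkWord a b c w p)

-- LE-symmetric: every permutation of L(N_{a,b,c}) lies in the group generated
-- by the t_i (since each t_i is an involution, the group generated is the set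
-- of words in the t_i).
LESymmetric : (a b c : ℕ) → Set
LESymmetric a b c =
  (σ : Inverse (LESetoid a b c) (LESetoid a b c)) →
  ∃ λ (w : List (Fin (a + b + c))) →
    ∀ (L : LinExt a b c) → bkWord a b c w (list L) ≡ list (Inverse.to σ L)

module Submission where

-- The Bender–Knuth moves are involutions, and permutations generated by involutions are
-- all permutations as soon as the action is connected and, for each generator τ, either
-- τ fixes a base point b or the transposition (b τb) is generated: conjugating along a
-- path from b then produces every transposition (b s).  For N_{1,1,c} a linear extension
-- is determined by the positions p of v₁ and q+1 of v₂, the chain v₃ < v₄ < ⋯ filling the
-- remaining positions in order; each t_i moves v₁ or v₂ by one step or does nothing.  The
-- base state has v₁v₃v₂ in front; t₁ and t₃ move it, and the words (t₁t₂)³ and (t₂t₃)³ act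
-- as the transpositions needed.  N_{a,1,1} is N_{1,1,a} read backwards with the order
-- reversed, and reading linear extensions backwards conjugates t_i to t_{n-i}.

open import Defs

open import Data.Bool using (Bool; true; false; T; _∧_; _∨_; if_then_else_)
open import Data.Bool.Properties using (T-∧; T-∨; T-≡)
open import Data.Empty using (⊥-elim)
open import Data.Fin using (Fin; toℕ; inject₁; punchOut; fromℕ<; opposite; cast)
  renaming (zero to fzero; suc to fsuc)
import Data.Fin.Induction as Fin
open import Data.Fin.Properties using (toℕ<n; toℕ-fromℕ<; toℕ-inject₁; any?; punchOut-injective; injective⇒≤)
import Data.Fin.Properties as Fin
open import Data.List using (List; []; _∷_; _++_; map; concatMap; cartesianProduct; upTo)
open import Data.List.Membership.Propositional using (_∈_)
import Data.List.Membership.Propositional as List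
open import Data.List.Membership.Propositional.Properties
  using (∈-allFin; ∈-concatMap⁺; ∈-cartesianProduct⁺; ∈-upTo⁺)
open import Data.List.Relation.Unary.Any using (here; there; satisfied)
open import Data.List.Relation.Unary.Any.Properties using (any⁺; any⁻)
open import Data.Nat using (ℕ; zero; suc; pred; _+_; _∸_; _≤_; _<_; _<ᵇ_; z≤n; s≤s; s≤s⁻¹)
import Data.Nat as ℕ
open import Data.Nat.Properties
  using ( n≮n; <-irrefl; <-asym; n<1+n; n≤1+n; ≤-refl; ≤-reflexive; ≤-trans; <-trans; <-≤-trans; ≤-<-trans
        ; <⇒≤; <⇒≤pred; <⇒≢; >⇒≢; ≰⇒>; <⇒≱; ≤∧≢⇒<; m≤n⇒m<n∨m≡n; n<1⇒n≡0; n≢0⇒n>0; <-cmp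
        ; suc-injective; ≤-irrelevant; <ᵇ⇒<; <⇒<ᵇ; +-comm; +-assoc; +-suc; m≤m+n; m≤n+m; m<m+n
        ; m∸n+n≡m; m∸n≤m; m+n∸m≡n; m∸[m∸n]≡n; +-∸-assoc; ∸-monoʳ-≤; ∸-monoʳ-<)
open import Data.Product using (∃-syntax; _×_; _,_; proj₁; proj₂; uncurry)
open import Data.Sum using (_⊎_; inj₁; inj₂)
open import Data.Vec using (Vec; lookup; _[_]≔_; tabulate)
import Data.Vec.Membership.Propositional as Vec
open import Data.Vec.Membership.Propositional.Properties using (∈-lookup)
open import Data.Vec.Properties using (lookup∘update; lookup∘update′; lookup∘tabulate; tabulate∘lookup; tabulate-cong)
open import Data.Vec.Relation.Unary.Any using (index)
open import Data.Vec.Relation.Unary.Any.Properties using (lookup-index)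
open import Function using (_∘_; id)
open import Function.Bundles using (Inverse; Injection; Equivalence; _⇔_; mk⇔)
import Function.Construct.Composition as Compose
import Function.Construct.Symmetry as Symmetry
open import Function.Definitions using (Injective)
open import Function.Properties.Inverse using (Inverse⇒Injection)
open import Induction.WellFounded using (module All)
open import Level using (0ℓ)
open import Relation.Binary.Definitions using (DecidableEquality; Tri; tri<; tri≈; tri>)
open import Relation.Binary.PropositionalEquality
open import Relation.Nullary using (¬_; Dec; yes; no; does)
open import Relation.Nullary.Decidable using (⌊_⌋; toWitness; fromWitness; dec-true; dec-false; isYes≗does; _×-dec_)

module Transposition {A : Set} (_≟_ : DecidableEquality A) where

  transpose : A → A → A → A
  transpose x y z with z ≟ x | z ≟ y
  ... | yes _ | _     = y
  ... | no _  | yes _ = x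
  ... | no _  | no _  = z

  data TransposeView (x y z : A) : A → Set where
    at-left   : z ≡ x → TransposeView x y z y
    at-right  : z ≢ x → z ≡ y → TransposeView x y z x
    elsewhere : z ≢ x → z ≢ y → TransposeView x y z z

  transpose-view : ∀ x y z → TransposeView x y z (transpose x y z)
  transpose-view x y z with z ≟ x | z ≟ y
  ... | yes z≡x | _     = at-left z≡x
  ... | no z≢x  | yes z≡y = at-right z≢x z≡y
  ... | no z≢x  | no z≢y  = elsewhere z≢x z≢y

  transpose-left : ∀ x y → transpose x y x ≡ y
  transpose-left x y with transpose x y x | transpose-view x y x
  ... | _ | at-left _       = refl
  ... | _ | at-right x≢x _  = ⊥-elim (x≢x refl)
  ... | _ | elsewhere x≢x _ = ⊥-elim (x≢x refl)

  transpose-right : ∀ x y → transpose x y y ≡ x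
  transpose-right x y with transpose x y y | transpose-view x y y
  ... | _ | at-left refl    = refl
  ... | _ | at-right _ _    = refl
  ... | _ | elsewhere _ y≢y = ⊥-elim (y≢y refl)

  transpose-other : ∀ {x y z} → z ≢ x → z ≢ y → transpose x y z ≡ z
  transpose-other {x} {y} {z} z≢x z≢y with transpose x y z | transpose-view x y z
  ... | _ | at-left z≡x    = ⊥-elim (z≢x z≡x)
  ... | _ | at-right _ z≡y = ⊥-elim (z≢y z≡y)
  ... | _ | elsewhere _ _  = refl

  transpose-same : ∀ x z → transpose x x z ≡ z
  transpose-same x z with transpose x x z | transpose-view x x z
  ... | _ | at-left z≡x     = sym z≡x
  ... | _ | at-right z≢x z≡x = ⊥-elim (z≢x z≡x)
  ... | _ | elsewhere _ _   = refl

  transpose-comm : ∀ x y z → transpose x y z ≡ transpose y x z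
  transpose-comm x y z with transpose x y z | transpose-view x y z
  ... | _ | at-left refl       = sym (transpose-right y z)
  ... | _ | at-right _ refl    = sym (transpose-left z x)
  ... | _ | elsewhere z≢x z≢y = sym (transpose-other z≢y z≢x)

  transpose-involutive : ∀ x y z → transpose x y (transpose x y z) ≡ z
  transpose-involutive x y z with transpose x y z | transpose-view x y z
  ... | _ | at-left refl    = transpose-right z y
  ... | _ | at-right _ refl = transpose-left x z
  ... | _ | elsewhere z≢x z≢y = transpose-other z≢x z≢y

  transpose-conjugate : ∀ x y z {t} → z ≢ x → z ≢ y → x ≢ y →
                        transpose x z (transpose z y (transpose x z t)) ≡ transpose x y t
  transpose-conjugate x y z {t} z≢x z≢y x≢y with transpose x z t | transpose-view x z t
  ... | _ | at-left refl = begin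
    transpose t z (transpose z y z) ≡⟨ cong (transpose t z) (transpose-left z y) ⟩
    transpose t z y                 ≡⟨ transpose-other (x≢y ∘ sym) (z≢y ∘ sym) ⟩
    y                               ≡⟨ transpose-left t y ⟨
    transpose t y t                 ∎
    where open ≡-Reasoning
  ... | _ | at-right t≢x refl = begin
    transpose x t (transpose t y x) ≡⟨ cong (transpose x t) (transpose-other (z≢x ∘ sym) x≢y) ⟩
    transpose x t x                 ≡⟨ transpose-left x t ⟩
    t                               ≡⟨ transpose-other t≢x z≢y ⟨
    transpose x y t                 ∎
    where open ≡-Reasoning
  ... | _ | elsewhere t≢x t≢z = by-cases (t ≟ y)
    where
    open ≡-Reasoning
    by-cases : Dec (t ≡ y) → transpose x z (transpose z y t) ≡ transpose x y t
    by-cases (yes refl) = begin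
      transpose x z (transpose z t t) ≡⟨ cong (transpose x z) (transpose-right z t) ⟩
      transpose x z z                 ≡⟨ transpose-right x z ⟩
      x                               ≡⟨ transpose-right x t ⟨
      transpose x t t                 ∎
    by-cases (no t≢y) = begin
      transpose x z (transpose z y t) ≡⟨ cong (transpose x z) (transpose-other t≢z t≢y) ⟩
      transpose x z t                 ≡⟨ transpose-other t≢x t≢z ⟩
      t                               ≡⟨ transpose-other t≢x t≢y ⟨
      transpose x y t                 ∎

module _ {A B : Set} (_≟A_ : DecidableEquality A) (_≟B_ : DecidableEquality B) where
  private
    module TA = Transposition _≟A_
    module TB = Transposition _≟B_

  transpose-natural : (f : A → B) → Injective _≡_ _≡_ f → ∀ x y z →
                      f (TA.transpose x y z) ≡ TB.transpose (f x) (f y) (f z)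
  transpose-natural f f-inj x y z with TA.transpose x y z | TA.transpose-view x y z
  ... | _ | TA.at-left refl      = sym (TB.transpose-left (f z) (f y))
  ... | _ | TA.at-right _ refl   = sym (TB.transpose-right (f x) (f z))
  ... | _ | TA.elsewhere z≢x z≢y = sym (TB.transpose-other (z≢x ∘ f-inj) (z≢y ∘ f-inj))

-- Permutations generated by involutions

module Generation {S : Set} (_≟_ : DecidableEquality S) {I : Set} (τ : I → S → S) where
  open Transposition _≟_

  act : List I → S → S
  act []      = id
  act (i ∷ w) = τ i ∘ act w

  Realizable : (S → S) → Set
  Realizable π = ∃[ w ] act w ≗ π

  act-++ : ∀ u w → act (u ++ w) ≗ act u ∘ act w
  act-++ []      w s = refl
  act-++ (i ∷ u) w s = cong (τ i) (act-++ u w s)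

  realizable-id : Realizable id
  realizable-id = [] , λ _ → refl

  realizable-generator : ∀ i → Realizable (τ i)
  realizable-generator i = i ∷ [] , λ _ → refl

  realizable-∘ : ∀ {f g} → Realizable f → Realizable g → Realizable (f ∘ g)
  realizable-∘ {f} {g} (u , u≗f) (w , w≗g) = u ++ w , λ s → begin
    act (u ++ w) s  ≡⟨ act-++ u w s ⟩
    act u (act w s) ≡⟨ cong (act u) (w≗g s) ⟩
    act u (g s)     ≡⟨ u≗f (g s) ⟩
    f (g s)         ∎
    where open ≡-Reasoning

  realizable-≗ : ∀ {f g} → Realizable f → f ≗ g → Realizable g
  realizable-≗ (w , w≗f) f≗g = w , λ s → trans (w≗f s) (f≗g s)

  realizable-transpose-comm : ∀ {x y} → Realizable (transpose x y) → Realizable (transpose y x)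
  realizable-transpose-comm {x} {y} r = realizable-≗ r (transpose-comm x y)

  realizable-transpose-via : ∀ {x y z} → z ≢ x → z ≢ y → x ≢ y →
                             Realizable (transpose x z) → Realizable (transpose z y) →
                             Realizable (transpose x y)
  realizable-transpose-via {x} {y} {z} z≢x z≢y x≢y xz zy =
    realizable-≗ (realizable-∘ (realizable-∘ xz zy) xz) (λ _ → transpose-conjugate x y z z≢x z≢y x≢y)

  module _ (involutive : ∀ i s → τ i (τ i s) ≡ s) (base : S)
           (connected : ∀ s → ∃[ w ] act w base ≡ s)
           (at-base : ∀ i → τ i base ≡ base ⊎ Realizable (transpose base (τ i base))) where

    realizable-conjugate : ∀ i {x y} → Realizable (transpose x y) →
                           Realizable (transpose (τ i x) (τ i y))
    realizable-conjugate i {x} {y} r =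
      realizable-≗ (realizable-∘ (realizable-∘ (realizable-generator i) r) (realizable-generator i)) λ s → begin
        τ i (transpose x y (τ i s))             ≡⟨ transpose-natural _≟_ _≟_ (τ i) τ-injective x y (τ i s) ⟩
        transpose (τ i x) (τ i y) (τ i (τ i s)) ≡⟨ cong (transpose (τ i x) (τ i y)) (involutive i s) ⟩
        transpose (τ i x) (τ i y) s             ∎
      where
      open ≡-Reasoning
      τ-injective : Injective _≡_ _≡_ (τ i)
      τ-injective {s} {t} eq = trans (sym (involutive i s)) (trans (cong (τ i) eq) (involutive i t))

    transpose-base-step : ∀ i s → Realizable (transpose base s) → Realizable (transpose base (τ i s))
    transpose-base-step i s r with realizable-conjugate i r | at-base i
    ... | r′ | inj₁ fixed = subst (λ b → Realizable (transpose b (τ i s))) fixed r′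
    ... | r′ | inj₂ r₀ with τ i s ≟ base | τ i s ≟ τ i base | base ≟ τ i base
    ...   | yes eq | _ | _ = realizable-≗ realizable-id λ z →
            trans (sym (transpose-same base z)) (cong (λ t → transpose base t z) (sym eq))
    ...   | no _ | yes eq | _ = subst (λ t → Realizable (transpose base t)) (sym eq) r₀
    ...   | no _ | no _ | yes eq = subst (λ b → Realizable (transpose b (τ i s))) (sym eq) r′
    ...   | no t≢b | no t≢b′ | no b≢b′ =
            realizable-transpose-via (b≢b′ ∘ sym) (t≢b′ ∘ sym) (t≢b ∘ sym) r₀ r′

    realizable-transpose-base : ∀ s → Realizable (transpose base s)
    realizable-transpose-base s with connected s
    ... | w , refl = along w
      where
      along : ∀ w → Realizable (transpose base (act w base))
      along []      = realizable-≗ realizable-id (sym ∘ transpose-same base)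
      along (i ∷ w) = transpose-base-step i (act w base) (along w)

    realizable-transpose : ∀ x y → Realizable (transpose x y)
    realizable-transpose x y with x ≟ base | y ≟ base | x ≟ y
    ... | yes refl | _ | _ = realizable-transpose-base y
    ... | no _ | yes refl | _ = realizable-transpose-comm (realizable-transpose-base x)
    ... | no _ | no _ | yes refl = realizable-≗ realizable-id (sym ∘ transpose-same x)
    ... | no x≢b | no y≢b | no x≢y =
          realizable-transpose-via (x≢b ∘ sym) (y≢b ∘ sym) x≢y
            (realizable-transpose-comm (realizable-transpose-base x)) (realizable-transpose-base y)

    realizable-supported : ∀ ks π → Injective _≡_ _≡_ π → (∀ s → s ∈ ks ⊎ π s ≡ s) → Realizable π
    realizable-supported [] π _ supp = realizable-≗ realizable-id λ s → fixed (supp s)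
      where
      fixed : ∀ {s} → s ∈ [] ⊎ π s ≡ s → s ≡ π s
      fixed (inj₂ πs≡s) = sym πs≡s
    realizable-supported (k ∷ ks) π π-inj supp =
      realizable-≗ (realizable-∘ (realizable-transpose k (π k)) (realizable-supported ks ρ ρ-inj ρ-supp))
                   (λ s → transpose-involutive k (π k) (π s))
      where
      ρ : S → S
      ρ = transpose k (π k) ∘ π
      ρ-inj : Injective _≡_ _≡_ ρ
      ρ-inj {s} {t} eq = π-inj (begin
        π s                                      ≡⟨ transpose-involutive k (π k) (π s) ⟨
        transpose k (π k) (ρ s)                  ≡⟨ cong (transpose k (π k)) eq ⟩
        transpose k (π k) (ρ t)                  ≡⟨ transpose-involutive k (π k) (π t) ⟩
        π t                                      ∎)
        where open ≡-Reasoning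
      ρ-supp : ∀ s → s ∈ ks ⊎ ρ s ≡ s
      ρ-supp s with s ≟ k | supp s
      ... | yes refl | _ = inj₂ (transpose-right s (π s))
      ... | no s≢k | inj₁ (here s≡k) = ⊥-elim (s≢k s≡k)
      ... | no _   | inj₁ (there s∈ks) = inj₁ s∈ks
      ... | no s≢k | inj₂ πs≡s = inj₂ (trans (cong (transpose k (π k)) πs≡s) (transpose-other s≢k s≢πk))
        where
        s≢πk : s ≢ π k
        s≢πk eq = s≢k (π-inj (trans πs≡s eq))

    realizable-injection : ∀ (elements : List S) → (∀ s → s ∈ elements) →
                           ∀ π → Injective _≡_ _≡_ π → Realizable π
    realizable-injection elements complete π π-inj =
      realizable-supported elements π π-inj (inj₁ ∘ complete)

injective⇒surjective : ∀ {n} {f : Fin n → Fin n} → Injective _≡_ _≡_ f → ∀ r → ∃[ x ] f x ≡ r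
injective⇒surjective {suc m} {f} f-injective r with any? (λ x → f x Fin.≟ r)
... | yes hit = hit
... | no miss = ⊥-elim (n≮n m (injective⇒≤ {f = skip-r} (f-injective ∘ punchOut-injective r≢f r≢f)))
  where
  r≢f : ∀ {x} → r ≢ f x
  r≢f {x} r≡fx = miss (x , sym r≡fx)
  skip-r : Fin (suc m) → Fin m
  skip-r x = punchOut (r≢f {x})

module CompleteVector {n : ℕ} (v : Vec (Fin n) n) (complete : ∀ x → x Vec.∈ v) where

  position : Fin n → Fin n
  position x = index (complete x)

  lookup-position : ∀ x → lookup v (position x) ≡ x
  lookup-position x = sym (lookup-index (complete x))

  position-injective : Injective _≡_ _≡_ position
  position-injective {x} {y} eq = trans (sym (lookup-position x)) (trans (cong (lookup v) eq) (lookup-position y))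

  lookup-injective : Injective _≡_ _≡_ (lookup v)
  lookup-injective {i} {j} eq with injective⇒surjective position-injective i | injective⇒surjective position-injective j
  ... | x , refl | y , refl = cong position (trans (sym (lookup-position x)) (trans eq (lookup-position y)))

  position-lookup : ∀ r → position (lookup v r) ≡ r
  position-lookup r = lookup-injective (lookup-position (lookup v r))

lookup-extensionality : ∀ {A : Set} {n} {u v : Vec A n} → (∀ i → lookup u i ≡ lookup v i) → u ≡ v
lookup-extensionality {u = u} {v} eq = trans (sym (tabulate∘lookup u)) (trans (tabulate-cong eq) (tabulate∘lookup v))

inject₁≢suc : ∀ {m} (i : Fin m) → inject₁ i ≢ fsuc i
inject₁≢suc i eq = <-irrefl (trans (sym (toℕ-inject₁ i)) (cong toℕ eq)) (n<1+n (toℕ i))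

module _ {a b c : ℕ} (i : Fin (a + b + c)) (v : Vec (Fin (Size a b c)) (Size a b c)) where
  open Transposition (Fin._≟_ {Size a b c})

  bk-comparable : comparableN a b c (lookup v (inject₁ i)) (lookup v (fsuc i)) ≡ true → bk a b c i v ≡ v
  bk-comparable eq rewrite eq = refl

  lookup-bk-incomparable : comparableN a b c (lookup v (inject₁ i)) (lookup v (fsuc i)) ≡ false →
                           ∀ j → lookup (bk a b c i v) j ≡ lookup v (transpose (inject₁ i) (fsuc i) j)
  lookup-bk-incomparable eq j rewrite eq with transpose (inject₁ i) (fsuc i) j | transpose-view (inject₁ i) (fsuc i) j
  ... | _ | at-left refl =
        trans (lookup∘update′ (inject₁≢suc i) (v [ inject₁ i ]≔ _) _) (lookup∘update (inject₁ i) v _)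
  ... | _ | at-right _ refl = lookup∘update (fsuc i) (v [ inject₁ i ]≔ _) _
  ... | _ | elsewhere j≢i j≢i+1 = trans (lookup∘update′ j≢i+1 (v [ inject₁ i ]≔ _) _) (lookup∘update′ j≢i v _)

module _ {a b c : ℕ} {S : Set} (_≟_ : DecidableEquality S) (τ : Fin (a + b + c) → S → S)
         (model : Inverse (LESetoid a b c) (setoid S))
         (bk-model : ∀ i s → bk a b c i (list (Inverse.from model s)) ≡ list (Inverse.from model (τ i s)))
  where
  open Generation _≟_ τ
  open Inverse model

  bkWord-model : ∀ w s → bkWord a b c w (list (from s)) ≡ list (from (act w s))
  bkWord-model []      s = refl
  bkWord-model (i ∷ w) s = trans (cong (bk a b c i) (bkWord-model w s)) (bk-model i (act w s))

  LESymmetric-from-model : (∀ π → Injective _≡_ _≡_ π → Realizable π) → LESymmetric a b c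
  LESymmetric-from-model realizable σ = realized (realizable (Inverse.to σ̃) (Injection.injective (Inverse⇒Injection σ̃)))
    where
    open ≡-Reasoning
    σ̃ : Inverse (setoid S) (setoid S)
    σ̃ = Compose.inverse (Symmetry.inverse model) (Compose.inverse σ model)
    realized : Realizable (Inverse.to σ̃) → ∃[ w ] ∀ L → bkWord a b c w (list L) ≡ list (Inverse.to σ L)
    realized (w , w≗σ̃) = w , λ L → begin
      bkWord a b c w (list L)                   ≡⟨ cong (bkWord a b c w) (sym (inverseʳ refl)) ⟩
      bkWord a b c w (list (from (to L)))       ≡⟨ bkWord-model w (to L) ⟩
      list (from (act w (to L)))                ≡⟨ cong (list ∘ from) (w≗σ̃ (to L)) ⟩
      list (from (Inverse.to σ̃ (to L)))         ≡⟨ inverseʳ refl ⟩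
      list (Inverse.to σ (from (to L)))         ≡⟨ Inverse.to-cong σ (inverseʳ refl) ⟩
      list (Inverse.to σ L)                     ∎

-- The order of N_{a,b,c}

-- Indices are 0-based.  The Hasse diagram is a path, so x < y iff the path from x to y only goes up.
data Below (a b : ℕ) : ℕ → ℕ → Set where
  ascent₁ : ∀ {x y} → x < y → y ≤ a → Below a b x y
  descent : ∀ {x y} → a ≤ y → y < x → x ≤ a + b → Below a b x y
  ascent₂ : ∀ {x y} → a + b ≤ x → x < y → Below a b x y

-- For b = 0 the poset is a chain and Below is not its order.
Below-trans : ∀ {a b x y z} → 1 ≤ b → Below a b x y → Below a b y z → Below a b x z
Below-trans _   (ascent₁ x<y _)   (ascent₁ y<z z≤a) = ascent₁ (<-trans x<y y<z) z≤a
Below-trans _   (ascent₁ _ y≤a)   (descent a≤z z<y _) = ⊥-elim (n≮n _ (<-≤-trans z<y (≤-trans y≤a a≤z)))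
Below-trans {a} 1≤b (ascent₁ _ y≤a) (ascent₂ a+b≤y _) = ⊥-elim (n≮n a (<-≤-trans (m<m+n a 1≤b) (≤-trans a+b≤y y≤a)))
Below-trans _   (descent a≤y _ _) (ascent₁ y<z z≤a) = ⊥-elim (n≮n _ (<-≤-trans y<z (≤-trans z≤a a≤y)))
Below-trans _   (descent _ y<x x≤a+b) (descent a≤z z<y _) = descent a≤z (<-trans z<y y<x) x≤a+b
Below-trans _   (descent _ y<x x≤a+b) (ascent₂ a+b≤y _) = ⊥-elim (n≮n _ (<-≤-trans y<x (≤-trans x≤a+b a+b≤y)))
Below-trans {a} _ (ascent₂ a+b≤x x<y) (ascent₁ y<z z≤a) =
  ⊥-elim (n≮n a (≤-<-trans (≤-trans (m≤m+n a _) a+b≤x) (<-≤-trans (<-trans x<y y<z) z≤a)))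
Below-trans _   (ascent₂ a+b≤x x<y) (descent _ _ y≤a+b) = ⊥-elim (n≮n _ (<-≤-trans x<y (≤-trans y≤a+b a+b≤x)))
Below-trans _   (ascent₂ a+b≤x x<y) (ascent₂ _ y<z) = ascent₂ a+b≤x (<-trans x<y y<z)

module Reach {n : ℕ} (R : Fin n → Fin n → Bool) where

  reach-suc⁻ : ∀ k {x y} → T (reach R (suc k) x y) → ∃[ z ] T (R x z) × (z ≡ y ⊎ T (reach R k z y))
  reach-suc⁻ k r with satisfied (any⁻ _ (allF n) r)
  ... | z , Rxz∧rest with Equivalence.to T-∧ Rxz∧rest
  ...   | Rxz , rest with Equivalence.to T-∨ rest
  ...     | inj₁ z≡y = z , Rxz , inj₁ (toWitness z≡y)
  ...     | inj₂ r′  = z , Rxz , inj₂ r′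

  reach-suc⁺ : ∀ k {x y} z → T (R x z) → z ≡ y ⊎ T (reach R k z y) → T (reach R (suc k) x y)
  reach-suc⁺ k z Rxz rest = any⁺ _ (List.lose (∈-allFin z) (Equivalence.from T-∧ (Rxz , Equivalence.from T-∨ (last rest))))
    where
    last : ∀ {y} → z ≡ y ⊎ T (reach R k z y) → T ⌊ z Fin.≟ y ⌋ ⊎ T (reach R k z y)
    last (inj₁ z≡y) = inj₁ (fromWitness z≡y)
    last (inj₂ r)   = inj₂ r

  reach-one : ∀ k {x y} → T (R x y) → T (reach R (suc k) x y)
  reach-one k {y = y} Rxy = reach-suc⁺ k y Rxy (inj₁ refl)

  reach-step : ∀ k {x y} → T (reach R k x y) → T (reach R (suc k) x y)
  reach-step (suc k) r with reach-suc⁻ k r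
  ... | z , Rxz , inj₁ refl = reach-one (suc k) Rxz
  ... | z , Rxz , inj₂ r′   = reach-suc⁺ (suc k) z Rxz (inj₂ (reach-step k r′))

  reach-mono : ∀ {k l x y} → k ≤ l → T (reach R k x y) → T (reach R l x y)
  reach-mono {k} {l} {x} {y} k≤l r = subst (λ m → T (reach R m x y)) (m∸n+n≡m k≤l) (lengthen (l ∸ k) r)
    where
    lengthen : ∀ d → T (reach R k x y) → T (reach R (d + k) x y)
    lengthen zero    r = r
    lengthen (suc d) r = reach-step (d + k) (lengthen d r)

  reach-⊆ : (P : Fin n → Fin n → Set) → (∀ {x y} → T (R x y) → P x y) → (∀ {x y z} → P x y → P y z → P x z) →
            ∀ k {x y} → T (reach R k x y) → P x y
  reach-⊆ P R⊆P P-trans (suc k) r with reach-suc⁻ k r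
  ... | z , Rxz , inj₁ refl = R⊆P Rxz
  ... | z , Rxz , inj₂ r′   = P-trans (R⊆P Rxz) (reach-⊆ P R⊆P P-trans k r′)

  reach-ascending : ∀ {lo hi} → (∀ {u v} → toℕ v ≡ suc (toℕ u) → lo ≤ toℕ u → toℕ v ≤ hi → T (R u v)) →
                    ∀ d {x y} → toℕ y ≡ suc (d + toℕ x) → lo ≤ toℕ x → toℕ y ≤ hi → T (reach R (suc d) x y)
  reach-ascending step zero    y≡ lo≤x y≤hi = reach-one 0 (step y≡ lo≤x y≤hi)
  reach-ascending step (suc d) {x} {y} y≡ lo≤x y≤hi =
    reach-suc⁺ (suc d) z (step z≡ lo≤x (≤-trans z≤y y≤hi))
      (inj₂ (reach-ascending step d y≡′ (≤-trans lo≤x (subst (toℕ x ≤_) (sym z≡) (n≤1+n _))) y≤hi))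
    where
    z<y : suc (toℕ x) < toℕ y
    z<y = subst (suc (toℕ x) <_) (sym y≡) (s≤s (s≤s (m≤n+m (toℕ x) d)))
    z : Fin n
    z = fromℕ< (<-trans z<y (toℕ<n y))
    z≡ : toℕ z ≡ suc (toℕ x)
    z≡ = toℕ-fromℕ< _
    z≤y : toℕ z ≤ toℕ y
    z≤y = subst (_≤ toℕ y) (sym z≡) (<⇒≤ z<y)
    y≡′ : toℕ y ≡ suc (d + toℕ z)
    y≡′ = trans y≡ (cong suc (trans (sym (+-suc d (toℕ x))) (cong (d +_) (sym z≡))))

  reach-descending : ∀ {lo hi} → (∀ {u v} → toℕ u ≡ suc (toℕ v) → lo ≤ toℕ v → toℕ u ≤ hi → T (R u v)) →
                     ∀ d {x y} → toℕ x ≡ suc (d + toℕ y) → lo ≤ toℕ y → toℕ x ≤ hi → T (reach R (suc d) x y)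
  reach-descending step zero    x≡ lo≤y x≤hi = reach-one 0 (step x≡ lo≤y x≤hi)
  reach-descending step (suc d) {x} {y} x≡ lo≤y x≤hi =
    reach-suc⁺ (suc d) z (step x≡′ (≤-trans lo≤y y≤z) x≤hi)
      (inj₂ (reach-descending step d z≡ lo≤y (≤-trans (subst (_≤ toℕ x) (sym z≡) (<⇒≤ z<x)) x≤hi)))
    where
    z<x : suc (d + toℕ y) < toℕ x
    z<x = subst (suc (d + toℕ y) <_) (sym x≡) ≤-refl
    z : Fin n
    z = fromℕ< (<-trans z<x (toℕ<n x))
    z≡ : toℕ z ≡ suc (d + toℕ y)
    z≡ = toℕ-fromℕ< _
    x≡′ : toℕ x ≡ suc (toℕ z)
    x≡′ = trans x≡ (cong suc (sym z≡))
    y≤z : toℕ y ≤ toℕ z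
    y≤z = subst (toℕ y ≤_) (sym z≡) (≤-trans (m≤n+m (toℕ y) d) (n≤1+n _))

⌊⌋-true : ∀ {A : Set} (a? : Dec A) → A → ⌊ a? ⌋ ≡ true
⌊⌋-true a? a = trans (isYes≗does a?) (dec-true a? a)

⌊⌋-false : ∀ {A : Set} (a? : Dec A) → ¬ A → ⌊ a? ⌋ ≡ false
⌊⌋-false a? ¬a = trans (isYes≗does a?) (dec-false a? ¬a)

T-∨⁻ : ∀ p q → T (p ∨ q) → T p ⊎ T q
T-∨⁻ p q = Equivalence.to (T-∨ {p} {q})

T-∧⁻ : ∀ p q → T (p ∧ q) → T p × T q
T-∧⁻ p q = Equivalence.to (T-∧ {p} {q})

T-⇔⇒≡ : ∀ {p q} → T p ⇔ T q → p ≡ q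
T-⇔⇒≡ {false} {false} _  = refl
T-⇔⇒≡ {false} {true}  pq = ⊥-elim (Equivalence.from pq _)
T-⇔⇒≡ {true}  {false} pq = ⊥-elim (Equivalence.to pq _)
T-⇔⇒≡ {true}  {true}  _  = refl

module _ {a b c : ℕ} {x y : Fin (Size a b c)} where
  private
    ≢2+ : ∀ {m} → m ≢ suc (suc m)
    ≢2+ {m} eq = <-irrefl eq (<-trans (n<1+n m) (n<1+n (suc m)))

  cover-ascent₁ : toℕ y ≡ suc (toℕ x) → toℕ x < a → T (cover a b c x y)
  cover-ascent₁ y≡ x<a rewrite ⌊⌋-true (toℕ y ℕ.≟ suc (toℕ x)) y≡ | ⌊⌋-true (toℕ x ℕ.<? a) x<a = _

  cover-descent : toℕ x ≡ suc (toℕ y) → a ≤ toℕ y → toℕ y < a + b → T (cover a b c x y)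
  cover-descent x≡ a≤y y<a+b
    rewrite ⌊⌋-false (toℕ y ℕ.≟ suc (toℕ x)) (λ y≡ → ≢2+ (trans y≡ (cong suc x≡)))
          | ⌊⌋-true (toℕ x ℕ.≟ suc (toℕ y)) x≡ | ⌊⌋-true (a ℕ.≤? toℕ y) a≤y | ⌊⌋-true (toℕ y ℕ.<? a + b) y<a+b = _

  cover-ascent₂ : toℕ y ≡ suc (toℕ x) → a + b ≤ toℕ x → toℕ x < a + b + c → T (cover a b c x y)
  cover-ascent₂ y≡ a+b≤x x<n
    rewrite ⌊⌋-true (toℕ y ℕ.≟ suc (toℕ x)) y≡
          | ⌊⌋-false (toℕ x ℕ.<? a) (λ x<a → n≮n a (≤-<-trans (≤-trans (m≤m+n a b) a+b≤x) x<a))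
          | ⌊⌋-false (toℕ x ℕ.≟ suc (toℕ y)) (λ x≡ → ≢2+ (trans x≡ (cong suc y≡)))
          | ⌊⌋-true (a + b ℕ.≤? toℕ x) a+b≤x | ⌊⌋-true (toℕ x ℕ.<? a + b + c) x<n = _

  cover⇒Below : T (cover a b c x y) → Below a b (toℕ x) (toℕ y)
  cover⇒Below t with T-∨⁻ ((toℕ y ==ᴺ suc (toℕ x)) ∧ (toℕ x <ᴺ a)) _ t
  ... | inj₁ t₁ with T-∧⁻ (toℕ y ==ᴺ suc (toℕ x)) _ t₁
  ...   | y≡ , x<a = ascent₁ (subst (toℕ x <_) (sym (toWitness y≡)) ≤-refl)
                             (subst (_≤ a) (sym (toWitness y≡)) (toWitness x<a))
  cover⇒Below t | inj₂ t₂ with T-∨⁻ ((toℕ x ==ᴺ suc (toℕ y)) ∧ ((a ≤ᴺ toℕ y) ∧ (toℕ y <ᴺ (a + b)))) _ t₂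
  ... | inj₁ t₃ with T-∧⁻ (toℕ x ==ᴺ suc (toℕ y)) _ t₃
  ...   | x≡ , t₄ with T-∧⁻ (a ≤ᴺ toℕ y) _ t₄
  ...     | a≤y , y<a+b = descent (toWitness a≤y) (subst (toℕ y <_) (sym (toWitness x≡)) ≤-refl)
                                  (subst (_≤ a + b) (sym (toWitness x≡)) (toWitness y<a+b))
  cover⇒Below t | inj₂ t₂ | inj₂ t₃ with T-∧⁻ (toℕ y ==ᴺ suc (toℕ x)) _ t₃
  ... | y≡ , t₄ = ascent₂ (toWitness (proj₁ (T-∧⁻ ((a + b) ≤ᴺ toℕ x) _ t₄)))
                          (subst (toℕ x <_) (sym (toWitness y≡)) ≤-refl)

∸-gap : ∀ {m n} → m < n → n ≡ suc ((n ∸ suc m) + m)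
∸-gap {m} {n} m<n = trans (sym (m∸n+n≡m m<n)) (+-suc (n ∸ suc m) m)

module _ {a b c : ℕ} where
  open Reach (cover a b c)

  private
    gap-length : ∀ {m} (y : Fin (Size a b c)) → m < toℕ y → suc (toℕ y ∸ suc m) ≤ Size a b c
    gap-length {m} y m<y = ≤-trans (s≤s (m≤m+n _ m)) (≤-trans (≤-reflexive (sym (∸-gap m<y))) (<⇒≤ (toℕ<n y)))

  Below⇒ltN : ∀ {x y} → Below a b (toℕ x) (toℕ y) → T (ltN a b c x y)
  Below⇒ltN {x} {y} (ascent₁ x<y y≤a) = reach-mono {l = Size a b c} (gap-length y x<y)
    (reach-ascending (λ v≡ _ v≤a → cover-ascent₁ v≡ (subst (_≤ a) v≡ v≤a)) _ (∸-gap x<y) z≤n y≤a)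
  Below⇒ltN {x} {y} (descent a≤y y<x x≤a+b) = reach-mono {l = Size a b c} (gap-length x y<x)
    (reach-descending (λ u≡ a≤v u≤a+b → cover-descent u≡ a≤v (subst (_≤ a + b) u≡ u≤a+b)) _ (∸-gap y<x) a≤y x≤a+b)
  Below⇒ltN {x} {y} (ascent₂ a+b≤x x<y) = reach-mono {l = Size a b c} (gap-length y x<y)
    (reach-ascending (λ v≡ a+b≤u v≤n → cover-ascent₂ v≡ a+b≤u (subst (_≤ a + b + c) v≡ v≤n)) _ (∸-gap x<y) a+b≤x
      (s≤s⁻¹ (toℕ<n y)))

  ltN⇔Below : 1 ≤ b → ∀ {x y} → T (ltN a b c x y) ⇔ Below a b (toℕ x) (toℕ y)
  ltN⇔Below 1≤b = mk⇔ (reach-⊆ (λ u v → Below a b (toℕ u) (toℕ v)) cover⇒Below (Below-trans 1≤b) (Size a b c)) Below⇒ltN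

-- Reading N_{a,b,c} backwards

module _ {a b c : ℕ} where
  private
    K : ℕ
    K = a + b + c

    K∸a≡c+b : K ∸ a ≡ c + b
    K∸a≡c+b = trans (cong (_∸ a) (+-assoc a b c)) (trans (m+n∸m≡n a (b + c)) (+-comm b c))

    K∸[a+b]≡c : K ∸ (a + b) ≡ c
    K∸[a+b]≡c = m+n∸m≡n (a + b) c

  Below-mirror : ∀ {x y} → x ≤ K → y ≤ K → Below a b x y → Below c b (K ∸ y) (K ∸ x)
  Below-mirror {x} {y} _ y≤K (ascent₁ x<y y≤a) =
    ascent₂ (subst (_≤ K ∸ y) K∸a≡c+b (∸-monoʳ-≤ K y≤a)) (∸-monoʳ-< x<y y≤K)
  Below-mirror {x} {y} x≤K _ (descent a≤y y<x x≤a+b) =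
    descent (subst (_≤ K ∸ x) K∸[a+b]≡c (∸-monoʳ-≤ K x≤a+b)) (∸-monoʳ-< y<x x≤K)
            (subst (K ∸ y ≤_) K∸a≡c+b (∸-monoʳ-≤ K a≤y))
  Below-mirror {x} {y} _ y≤K (ascent₂ a+b≤x x<y) =
    ascent₁ (∸-monoʳ-< x<y y≤K) (subst (K ∸ x ≤_) K∸[a+b]≡c (∸-monoʳ-≤ K a+b≤x))

-- Index k of N_{a,b,c} becomes index K ∸ k of N_{c,b,a}, which reverses the order (ltN-mirror),
-- and the move at positions i, i + 1 becomes the move at positions K ∸ (i + 1), K ∸ i.
module Mirror (a b c : ℕ) where

  K : ℕ
  K = a + b + c

  K≡c+b+a : K ≡ c + b + a
  K≡c+b+a = trans (+-comm (a + b) c) (trans (cong (c +_) (+-comm a b)) (sym (+-assoc c b a)))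

  mirror : Fin (Size a b c) → Fin (Size c b a)
  mirror = cast (cong suc K≡c+b+a) ∘ opposite

  mirror⁻ : Fin (Size c b a) → Fin (Size a b c)
  mirror⁻ = opposite ∘ cast (cong suc (sym K≡c+b+a))

  toℕ-mirror : ∀ x → toℕ (mirror x) ≡ K ∸ toℕ x
  toℕ-mirror x = trans (Fin.toℕ-cast _ (opposite x)) (Fin.opposite-prop x)

  toℕ-mirror⁻ : ∀ y → toℕ (mirror⁻ y) ≡ K ∸ toℕ y
  toℕ-mirror⁻ y = trans (Fin.opposite-prop (cast (cong suc (sym K≡c+b+a)) y)) (cong (K ∸_) (Fin.toℕ-cast (cong suc (sym K≡c+b+a)) y))

  mirror⁻-mirror : ∀ x → mirror⁻ (mirror x) ≡ x
  mirror⁻-mirror x = Fin.toℕ-injective (begin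
    toℕ (mirror⁻ (mirror x)) ≡⟨ toℕ-mirror⁻ (mirror x) ⟩
    K ∸ toℕ (mirror x)       ≡⟨ cong (K ∸_) (toℕ-mirror x) ⟩
    K ∸ (K ∸ toℕ x)          ≡⟨ m∸[m∸n]≡n (s≤s⁻¹ (toℕ<n x)) ⟩
    toℕ x                    ∎)
    where open ≡-Reasoning

  mirror-mirror⁻ : ∀ y → mirror (mirror⁻ y) ≡ y
  mirror-mirror⁻ y = Fin.toℕ-injective (begin
    toℕ (mirror (mirror⁻ y)) ≡⟨ toℕ-mirror (mirror⁻ y) ⟩
    K ∸ toℕ (mirror⁻ y)      ≡⟨ cong (K ∸_) (toℕ-mirror⁻ y) ⟩
    K ∸ (K ∸ toℕ y)          ≡⟨ m∸[m∸n]≡n (subst (toℕ y ≤_) (sym K≡c+b+a) (s≤s⁻¹ (toℕ<n y))) ⟩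
    toℕ y                    ∎)
    where open ≡-Reasoning

  mirror-move : Fin (a + b + c) → Fin (c + b + a)
  mirror-move = cast K≡c+b+a ∘ opposite

  toℕ-mirror-move : ∀ i → toℕ (mirror-move i) ≡ K ∸ suc (toℕ i)
  toℕ-mirror-move i = trans (Fin.toℕ-cast _ (opposite i)) (Fin.opposite-prop i)

  reverseVec : Vec (Fin (Size a b c)) (Size a b c) → Vec (Fin (Size c b a)) (Size c b a)
  reverseVec v = tabulate (mirror ∘ lookup v ∘ mirror⁻)

  reverseVec⁻ : Vec (Fin (Size c b a)) (Size c b a) → Vec (Fin (Size a b c)) (Size a b c)
  reverseVec⁻ w = tabulate (mirror⁻ ∘ lookup w ∘ mirror)

  lookup-reverseVec : ∀ v j → lookup (reverseVec v) j ≡ mirror (lookup v (mirror⁻ j))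
  lookup-reverseVec v = lookup∘tabulate (mirror ∘ lookup v ∘ mirror⁻)

  lookup-reverseVec⁻ : ∀ w j → lookup (reverseVec⁻ w) j ≡ mirror⁻ (lookup w (mirror j))
  lookup-reverseVec⁻ w = lookup∘tabulate (mirror⁻ ∘ lookup w ∘ mirror)

  reverseVec⁻-reverseVec : ∀ v → reverseVec⁻ (reverseVec v) ≡ v
  reverseVec⁻-reverseVec v = lookup-extensionality λ j → begin
    lookup (reverseVec⁻ (reverseVec v)) j                   ≡⟨ lookup-reverseVec⁻ (reverseVec v) j ⟩
    mirror⁻ (lookup (reverseVec v) (mirror j))              ≡⟨ cong mirror⁻ (lookup-reverseVec v (mirror j)) ⟩
    mirror⁻ (mirror (lookup v (mirror⁻ (mirror j))))        ≡⟨ mirror⁻-mirror _ ⟩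
    lookup v (mirror⁻ (mirror j))                           ≡⟨ cong (lookup v) (mirror⁻-mirror j) ⟩
    lookup v j                                              ∎
    where open ≡-Reasoning

  reverseVec-reverseVec⁻ : ∀ w → reverseVec (reverseVec⁻ w) ≡ w
  reverseVec-reverseVec⁻ w = lookup-extensionality λ j → begin
    lookup (reverseVec (reverseVec⁻ w)) j                   ≡⟨ lookup-reverseVec (reverseVec⁻ w) j ⟩
    mirror (lookup (reverseVec⁻ w) (mirror⁻ j))             ≡⟨ cong mirror (lookup-reverseVec⁻ w (mirror⁻ j)) ⟩
    mirror (mirror⁻ (lookup w (mirror (mirror⁻ j))))        ≡⟨ mirror-mirror⁻ _ ⟩
    lookup w (mirror (mirror⁻ j))                           ≡⟨ cong (lookup w) (mirror-mirror⁻ j) ⟩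
    lookup w j                                              ∎
    where open ≡-Reasoning

  mirror⁻-injective : Injective _≡_ _≡_ mirror⁻
  mirror⁻-injective {y} {y′} eq = trans (sym (mirror-mirror⁻ y)) (trans (cong mirror eq) (mirror-mirror⁻ y′))

  mirror⁻-inject₁-move : ∀ i → mirror⁻ (inject₁ (mirror-move i)) ≡ fsuc i
  mirror⁻-inject₁-move i = Fin.toℕ-injective (begin
    toℕ (mirror⁻ (inject₁ (mirror-move i))) ≡⟨ toℕ-mirror⁻ (inject₁ (mirror-move i)) ⟩
    K ∸ toℕ (inject₁ (mirror-move i))       ≡⟨ cong (K ∸_) (trans (toℕ-inject₁ (mirror-move i)) (toℕ-mirror-move i)) ⟩
    K ∸ (K ∸ suc (toℕ i))                   ≡⟨ m∸[m∸n]≡n (toℕ<n i) ⟩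
    suc (toℕ i)                             ∎)
    where open ≡-Reasoning

  mirror⁻-suc-move : ∀ i → mirror⁻ (fsuc (mirror-move i)) ≡ inject₁ i
  mirror⁻-suc-move i = Fin.toℕ-injective (begin
    toℕ (mirror⁻ (fsuc (mirror-move i)))   ≡⟨ toℕ-mirror⁻ (fsuc (mirror-move i)) ⟩
    K ∸ suc (toℕ (mirror-move i))          ≡⟨ cong (λ m → K ∸ suc m) (toℕ-mirror-move i) ⟩
    K ∸ suc (K ∸ suc (toℕ i))              ≡⟨ cong (K ∸_) (+-∸-assoc 1 (toℕ<n i)) ⟨
    K ∸ (K ∸ toℕ i)                        ≡⟨ m∸[m∸n]≡n (<⇒≤ (toℕ<n i)) ⟩
    toℕ i                                  ≡⟨ toℕ-inject₁ i ⟨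
    toℕ (inject₁ i)                        ∎)
    where open ≡-Reasoning

  module _ (1≤b : 1 ≤ b) where

    ltN-mirror : ∀ x y → ltN c b a (mirror x) (mirror y) ≡ ltN a b c y x
    ltN-mirror x y = T-⇔⇒≡ (mk⇔
      (λ t → Equivalence.from (ltN⇔Below 1≤b) (Below-mirror⁻ (s≤s⁻¹ (toℕ<n x)) (s≤s⁻¹ (toℕ<n y))
        (subst₂ (Below c b) (toℕ-mirror x) (toℕ-mirror y) (Equivalence.to (ltN⇔Below 1≤b) t))))
      (λ t → Equivalence.from (ltN⇔Below 1≤b) (subst₂ (Below c b) (sym (toℕ-mirror x)) (sym (toℕ-mirror y))
        (Below-mirror (s≤s⁻¹ (toℕ<n y)) (s≤s⁻¹ (toℕ<n x)) (Equivalence.to (ltN⇔Below 1≤b) t)))))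
      where
      Below-mirror⁻ : ∀ {x y} → x ≤ K → y ≤ K → Below c b (K ∸ x) (K ∸ y) → Below a b y x
      Below-mirror⁻ {x} {y} x≤K y≤K B = subst₂ (Below a b) (cancel y≤K) (cancel x≤K)
        (Below-mirror {c} {b} {a} (bound x) (bound y) B)
        where
        bound : ∀ z → K ∸ z ≤ c + b + a
        bound z = subst (K ∸ z ≤_) K≡c+b+a (m∸n≤m K z)
        cancel : ∀ {z} → z ≤ K → c + b + a ∸ (K ∸ z) ≡ z
        cancel {z} z≤K = trans (cong (_∸ (K ∸ z)) (sym K≡c+b+a)) (m∸[m∸n]≡n z≤K)

    comparable-mirror : ∀ x y → comparableN c b a (mirror y) (mirror x) ≡ comparableN a b c x y
    comparable-mirror x y = cong₂ _∨_ (ltN-mirror y x) (ltN-mirror x y)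

    comparable-reverseVec : ∀ i v →
      comparableN c b a (lookup (reverseVec v) (inject₁ (mirror-move i))) (lookup (reverseVec v) (fsuc (mirror-move i)))
      ≡ comparableN a b c (lookup v (inject₁ i)) (lookup v (fsuc i))
    comparable-reverseVec i v =
      trans (cong₂ (comparableN c b a)
              (trans (lookup-reverseVec v (inject₁ (mirror-move i))) (cong (mirror ∘ lookup v) (mirror⁻-inject₁-move i)))
              (trans (lookup-reverseVec v (fsuc (mirror-move i))) (cong (mirror ∘ lookup v) (mirror⁻-suc-move i))))
            (comparable-mirror (lookup v (inject₁ i)) (lookup v (fsuc i)))

    bk-reverseVec : ∀ i v → bk c b a (mirror-move i) (reverseVec v) ≡ reverseVec (bk a b c i v)
    bk-reverseVec i v = by-cases _ refl
      where
      open ≡-Reasoning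
      open Transposition (Fin._≟_ {Size c b a})
      module T′ = Transposition (Fin._≟_ {Size a b c})
      g : Fin (c + b + a)
      g = mirror-move i
      by-cases : ∀ β → comparableN a b c (lookup v (inject₁ i)) (lookup v (fsuc i)) ≡ β →
                 bk c b a g (reverseVec v) ≡ reverseVec (bk a b c i v)
      by-cases true comparable =
        trans (bk-comparable {c} {b} {a} g (reverseVec v) (trans (comparable-reverseVec i v) comparable))
              (cong reverseVec (sym (bk-comparable {a} {b} {c} i v comparable)))
      by-cases false incomparable = lookup-extensionality λ j → begin
        lookup (bk c b a g (reverseVec v)) j
          ≡⟨ lookup-bk-incomparable {c} {b} {a} g (reverseVec v) (trans (comparable-reverseVec i v) incomparable) j ⟩
        lookup (reverseVec v) (transpose (inject₁ g) (fsuc g) j)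
          ≡⟨ lookup-reverseVec v (transpose (inject₁ g) (fsuc g) j) ⟩
        mirror (lookup v (mirror⁻ (transpose (inject₁ g) (fsuc g) j)))
          ≡⟨ cong (mirror ∘ lookup v) (transpose-natural Fin._≟_ Fin._≟_ mirror⁻ mirror⁻-injective (inject₁ g) (fsuc g) j) ⟩
        mirror (lookup v (T′.transpose (mirror⁻ (inject₁ g)) (mirror⁻ (fsuc g)) (mirror⁻ j)))
          ≡⟨ cong₂ (λ p q → mirror (lookup v (T′.transpose p q (mirror⁻ j)))) (mirror⁻-inject₁-move i) (mirror⁻-suc-move i) ⟩
        mirror (lookup v (T′.transpose (fsuc i) (inject₁ i) (mirror⁻ j)))
          ≡⟨ cong (mirror ∘ lookup v) (T′.transpose-comm (fsuc i) (inject₁ i) (mirror⁻ j)) ⟩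
        mirror (lookup v (T′.transpose (inject₁ i) (fsuc i) (mirror⁻ j)))
          ≡⟨ cong mirror (lookup-bk-incomparable {a} {b} {c} i v incomparable (mirror⁻ j)) ⟨
        mirror (lookup (bk a b c i v) (mirror⁻ j))
          ≡⟨ lookup-reverseVec (bk a b c i v) j ⟨
        lookup (reverseVec (bk a b c i v)) j
          ∎

    reverseLE : LinExt a b c → LinExt c b a
    reverseLE L = record { list = reverseVec (list L) ; all = complete ; order = reversed-order }
      where
      v : Vec (Fin (Size a b c)) (Size a b c)
      v = list L
      complete : ∀ y → y Vec.∈ reverseVec v
      complete y = subst (Vec._∈ reverseVec v) (begin
        lookup (reverseVec v) (mirror k)       ≡⟨ lookup-reverseVec v (mirror k) ⟩
        mirror (lookup v (mirror⁻ (mirror k))) ≡⟨ cong (mirror ∘ lookup v) (mirror⁻-mirror k) ⟩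
        mirror (lookup v k)                    ≡⟨ cong mirror (lookup-position (mirror⁻ y)) ⟩
        mirror (mirror⁻ y)                     ≡⟨ mirror-mirror⁻ y ⟩
        y                                      ∎) (∈-lookup (mirror k) (reverseVec v))
        where
        open ≡-Reasoning
        open CompleteVector v (LinExt.all L)
        k : Fin (Size a b c)
        k = position (mirror⁻ y)
      reversed-order : ∀ i j → T (ltN c b a (lookup (reverseVec v) i) (lookup (reverseVec v) j)) → toℕ i < toℕ j
      reversed-order i j t = ≰⇒> λ j≤i → <⇒≱ (subst₂ _<_ (toℕ-mirror⁻ j) (toℕ-mirror⁻ i) j<i) (∸-monoʳ-≤ K j≤i)
        where
        j<i : toℕ (mirror⁻ j) < toℕ (mirror⁻ i)
        j<i = LinExt.order L (mirror⁻ j) (mirror⁻ i) (subst T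
          (trans (cong₂ (ltN c b a) (lookup-reverseVec v i) (lookup-reverseVec v j)) (ltN-mirror _ _)) t)

module _ {a b c : ℕ} (1≤b : 1 ≤ b) where
  private
    module F = Mirror a b c
    module B = Mirror c b a

    mirror-back : ∀ y → B.mirror y ≡ F.mirror⁻ y
    mirror-back y = Fin.toℕ-injective (trans (B.toℕ-mirror y) (trans (cong (_∸ toℕ y) (sym F.K≡c+b+a)) (sym (F.toℕ-mirror⁻ y))))

    mirror⁻-back : ∀ x → B.mirror⁻ x ≡ F.mirror x
    mirror⁻-back x = Fin.toℕ-injective (trans (B.toℕ-mirror⁻ x) (trans (cong (_∸ toℕ x) (sym F.K≡c+b+a)) (sym (F.toℕ-mirror x))))

    reverseVec-back : ∀ w → B.reverseVec w ≡ F.reverseVec⁻ w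
    reverseVec-back w = tabulate-cong λ j → trans (mirror-back (lookup w (B.mirror⁻ j))) (cong (F.mirror⁻ ∘ lookup w) (mirror⁻-back j))

  reversal : Inverse (LESetoid a b c) (LESetoid c b a)
  reversal = record
    { to        = F.reverseLE 1≤b
    ; from      = B.reverseLE 1≤b
    ; to-cong   = cong F.reverseVec
    ; from-cong = cong B.reverseVec
    ; inverse   = (λ {L′} {L} L≈ → trans (cong F.reverseVec L≈)
                     (trans (cong F.reverseVec (reverseVec-back (list L′))) (F.reverseVec-reverseVec⁻ (list L′))))
                , (λ {L} {L′} L′≈ → trans (cong B.reverseVec L′≈)
                     (trans (reverseVec-back (F.reverseVec (list L))) (F.reverseVec⁻-reverseVec (list L))))
    }

  bkWord-reverseVec : ∀ w v → bkWord c b a (map F.mirror-move w) (F.reverseVec v) ≡ F.reverseVec (bkWord a b c w v)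
  bkWord-reverseVec []      v = refl
  bkWord-reverseVec (i ∷ w) v =
    trans (cong (bk c b a (F.mirror-move i)) (bkWord-reverseVec w v)) (F.bk-reverseVec 1≤b i (bkWord a b c w v))

  LESymmetric-mirror : LESymmetric a b c → LESymmetric c b a
  LESymmetric-mirror symmetric σ′ = realized (symmetric σ)
    where
    open ≡-Reasoning
    open Inverse reversal
    σ : Inverse (LESetoid a b c) (LESetoid a b c)
    σ = Compose.inverse reversal (Compose.inverse σ′ (Symmetry.inverse reversal))
    realized : (∃[ w ] ∀ L → bkWord a b c w (list L) ≡ list (Inverse.to σ L)) →
               ∃[ w′ ] ∀ L′ → bkWord c b a w′ (list L′) ≡ list (Inverse.to σ′ L′)
    realized (w , w-realizes) = map F.mirror-move w , λ L′ → begin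
      bkWord c b a (map F.mirror-move w) (list L′)
        ≡⟨ cong (bkWord c b a (map F.mirror-move w)) (inverseˡ {L′} {from L′} refl) ⟨
      bkWord c b a (map F.mirror-move w) (F.reverseVec (list (from L′)))
        ≡⟨ bkWord-reverseVec w (list (from L′)) ⟩
      F.reverseVec (bkWord a b c w (list (from L′)))
        ≡⟨ cong F.reverseVec (w-realizes (from L′)) ⟩
      list (to (Inverse.to σ (from L′)))
        ≡⟨ inverseˡ {Inverse.to σ′ (to (from L′))} {from (Inverse.to σ′ (to (from L′)))} refl ⟩
      list (Inverse.to σ′ (to (from L′)))
        ≡⟨ Inverse.to-cong σ′ (inverseˡ {L′} {from L′} refl) ⟩
      list (Inverse.to σ′ L′)
        ∎

-- Linear extensions of N_{1,1,c}

_≺_ : ℕ → ℕ → Bool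
zero           ≺ suc zero    = true
suc (suc j)    ≺ suc (suc l) = j <ᵇ l
suc (suc zero) ≺ suc zero    = true
_              ≺ _           = false

≺⇔Below : ∀ {x y} → T (x ≺ y) ⇔ Below 1 1 x y
≺⇔Below = mk⇔ to from
  where
  to : ∀ {x y} → T (x ≺ y) → Below 1 1 x y
  to {zero}                {suc zero}    _ = ascent₁ ≤-refl ≤-refl
  to {suc (suc j)}         {suc (suc l)} t = ascent₂ (s≤s (s≤s z≤n)) (s≤s (s≤s (<ᵇ⇒< j l t)))
  to {suc (suc zero)}      {suc zero}    _ = descent ≤-refl ≤-refl ≤-refl
  from : ∀ {x y} → Below 1 1 x y → T (x ≺ y)
  from (ascent₁ {zero}  {suc zero} _ _)                                = _
  from (ascent₁ {suc _} {suc zero} (s≤s ()) _)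
  from (ascent₁ {_}     {suc (suc _)} _ (s≤s ()))
  from (descent {suc (suc zero)} {suc zero} _ _ _)                     = _
  from (descent {_} {zero} () _ _)
  from (descent {suc zero} {suc zero} _ (s≤s ()) _)
  from (descent {suc (suc (suc _))} {suc zero} _ _ (s≤s (s≤s ())))
  from (descent {_} {suc (suc _)} _ (s≤s (s≤s (s≤s _))) (s≤s (s≤s ())))
  from (ascent₂ {zero} () _)
  from (ascent₂ {suc zero} (s≤s ()) _)
  from (ascent₂ {suc (suc _)} {suc zero} _ (s≤s ()))
  from (ascent₂ {suc (suc j)} {suc (suc l)} _ (s≤s (s≤s j<l)))         = <⇒<ᵇ j<l

ltN-≺ : ∀ {c} (x y : Fin (Size 1 1 c)) → ltN 1 1 c x y ≡ toℕ x ≺ toℕ y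
ltN-≺ {c} x y = T-⇔⇒≡ {ltN 1 1 c x y} {toℕ x ≺ toℕ y} (mk⇔
  (Equivalence.from (≺⇔Below {toℕ x} {toℕ y}) ∘ Equivalence.to (ltN⇔Below {1} {1} {c} ≤-refl {x} {y}))
  (Equivalence.from (ltN⇔Below {1} {1} {c} ≤-refl {x} {y}) ∘ Equivalence.to (≺⇔Below {toℕ x} {toℕ y})))

module ℕ-Transposition = Transposition ℕ._≟_

swap : ℕ → ℕ → ℕ
swap k = ℕ-Transposition.transpose k (suc k)

insert : ℕ → ℕ → (ℕ → ℕ) → ℕ → ℕ
insert P e h r with <-cmp r P
... | tri< _ _ _ = h r
... | tri≈ _ _ _ = e
... | tri> _ _ _ = h (pred r)

module _ {P e : ℕ} {h : ℕ → ℕ} where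

  insert-< : ∀ {r} → r < P → insert P e h r ≡ h r
  insert-< {r} r<P with <-cmp r P
  ... | tri< _ _ _    = refl
  ... | tri≈ r≮P _ _  = ⊥-elim (r≮P r<P)
  ... | tri> r≮P _ _  = ⊥-elim (r≮P r<P)

  insert-≡ : ∀ {r} → r ≡ P → insert P e h r ≡ e
  insert-≡ {r} r≡P with <-cmp r P
  ... | tri< _ r≢P _  = ⊥-elim (r≢P r≡P)
  ... | tri≈ _ _ _    = refl
  ... | tri> _ r≢P _  = ⊥-elim (r≢P r≡P)

  insert-> : ∀ {r} → P < r → insert P e h r ≡ h (pred r)
  insert-> {r} P<r with <-cmp r P
  ... | tri< _ _ r≯P  = ⊥-elim (r≯P P<r)
  ... | tri≈ _ _ r≯P  = ⊥-elim (r≯P P<r)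
  ... | tri> _ _ _    = refl

swap-involutive : ∀ k r → swap k (swap k r) ≡ r
swap-involutive k = ℕ-Transposition.transpose-involutive k (suc k)

swap-other : ∀ {k r} → r ≢ k → r ≢ suc k → swap k r ≡ r
swap-other = ℕ-Transposition.transpose-other

insert-shift : ∀ P e h → insert (suc P) e h ≗ insert P e h ∘ swap P
insert-shift P e h r = by-cases (<-cmp r P) (<-cmp r (suc P))
  where
  open ≡-Reasoning
  by-cases : Tri (r < P) (r ≡ P) (P < r) → Tri (r < suc P) (r ≡ suc P) (suc P < r) →
             insert (suc P) e h r ≡ insert P e h (swap P r)
  by-cases (tri< r<P _ _) _ = begin
    insert (suc P) e h r     ≡⟨ insert-< (<-trans r<P (n<1+n P)) ⟩
    h r                      ≡⟨ insert-< r<P ⟨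
    insert P e h r           ≡⟨ cong (insert P e h) (swap-other (<⇒≢ r<P) (<⇒≢ (<-trans r<P (n<1+n P)))) ⟨
    insert P e h (swap P r)  ∎
  by-cases (tri≈ _ r≡P _) _ = begin
    insert (suc P) e h r     ≡⟨ insert-< (subst (_< suc P) (sym r≡P) (n<1+n P)) ⟩
    h r                      ≡⟨ cong h r≡P ⟩
    h P                      ≡⟨ insert-> (n<1+n P) ⟨
    insert P e h (suc P)     ≡⟨ cong (insert P e h) (trans (cong (swap P) r≡P) (ℕ-Transposition.transpose-left P (suc P))) ⟨
    insert P e h (swap P r)  ∎
  by-cases (tri> _ _ P<r) (tri< r<P+1 _ _) = ⊥-elim (<⇒≱ P<r (s≤s⁻¹ r<P+1))
  by-cases (tri> _ _ P<r) (tri≈ _ r≡P+1 _) = begin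
    insert (suc P) e h r     ≡⟨ insert-≡ r≡P+1 ⟩
    e                        ≡⟨ insert-≡ {P} {e} {h} refl ⟨
    insert P e h P           ≡⟨ cong (insert P e h) (trans (cong (swap P) r≡P+1) (ℕ-Transposition.transpose-right P (suc P))) ⟨
    insert P e h (swap P r)  ∎
  by-cases (tri> _ _ P<r) (tri> _ _ P+1<r) = begin
    insert (suc P) e h r     ≡⟨ insert-> P+1<r ⟩
    h (pred r)               ≡⟨ insert-> P<r ⟨
    insert P e h r           ≡⟨ cong (insert P e h) (swap-other (>⇒≢ P<r) (>⇒≢ P+1<r)) ⟨
    insert P e h (swap P r)  ∎

insert-cong : ∀ P e {h h′} → h ≗ h′ → insert P e h ≗ insert P e h′
insert-cong P e h≗h′ r with <-cmp r P
... | tri< _ _ _ = h≗h′ r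
... | tri≈ _ _ _ = refl
... | tri> _ _ _ = h≗h′ (pred r)

insert-swap-below : ∀ P e h {k} → suc k < P → insert P e (h ∘ swap k) ≗ insert P e h ∘ swap k
insert-swap-below P e h {k} k+1<P r = by-cases (<-cmp r P)
  where
  open ≡-Reasoning
  k<P : k < P
  k<P = <-trans (n<1+n k) k+1<P
  by-cases : Tri (r < P) (r ≡ P) (P < r) → insert P e (h ∘ swap k) r ≡ insert P e h (swap k r)
  by-cases (tri< r<P _ _) = trans (insert-< r<P) (sym (insert-< swap<P))
    where
    swap<P : swap k r < P
    swap<P with swap k r | ℕ-Transposition.transpose-view k (suc k) r
    ... | _ | ℕ-Transposition.at-left _     = k+1<P
    ... | _ | ℕ-Transposition.at-right _ _  = k<P
    ... | _ | ℕ-Transposition.elsewhere _ _ = r<P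
  by-cases (tri≈ _ r≡P _) = begin
    insert P e (h ∘ swap k) r  ≡⟨ insert-≡ r≡P ⟩
    e                          ≡⟨ insert-≡ r≡P ⟨
    insert P e h r             ≡⟨ cong (insert P e h) (swap-other r≢k r≢k+1) ⟨
    insert P e h (swap k r)    ∎
    where
    r≢k : r ≢ k
    r≢k r≡k = <-irrefl (trans (sym r≡k) r≡P) k<P
    r≢k+1 : r ≢ suc k
    r≢k+1 r≡k+1 = <-irrefl (trans (sym r≡k+1) r≡P) k+1<P
  by-cases (tri> _ _ P<r) = begin
    insert P e (h ∘ swap k) r  ≡⟨ insert-> P<r ⟩
    h (swap k (pred r))        ≡⟨ cong h (swap-other (>⇒≢ (<-≤-trans k<P P≤r-1)) (>⇒≢ (<-≤-trans k+1<P P≤r-1))) ⟩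
    h (pred r)                 ≡⟨ insert-> P<r ⟨
    insert P e h r             ≡⟨ cong (insert P e h) (swap-other (>⇒≢ (<-trans k<P P<r)) (>⇒≢ (<-trans k+1<P P<r))) ⟨
    insert P e h (swap k r)    ∎
    where
    P≤r-1 : P ≤ pred r
    P≤r-1 = <⇒≤pred P<r

chain : ℕ → ℕ
chain m = suc (suc m)

-- placement p q r is the label at position r of the linear extension with 0 at position p,
-- 1 at position q + 1, and the chain 2 < 3 < ⋯ in the remaining positions.
placement : ℕ → ℕ → ℕ → ℕ
placement p q = insert (suc q) 1 (insert p 0 chain)

placement-move-zero : ∀ {k q} → k < q → placement (suc k) q ≗ placement k q ∘ swap k
placement-move-zero {k} {q} k<q r = begin
  insert (suc q) 1 (insert (suc k) 0 chain) r        ≡⟨ insert-cong (suc q) 1 (insert-shift k 0 chain) r ⟩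
  insert (suc q) 1 (insert k 0 chain ∘ swap k) r     ≡⟨ insert-swap-below (suc q) 1 (insert k 0 chain) (s≤s k<q) r ⟩
  insert (suc q) 1 (insert k 0 chain) (swap k r)     ∎
  where open ≡-Reasoning

placement-move-one : ∀ p q → placement p (suc q) ≗ placement p q ∘ swap (suc q)
placement-move-one p q = insert-shift (suc q) 1 (insert p 0 chain)

module _ {p q : ℕ} (p≤q : p ≤ q) where

  placement-before : ∀ {r} → r < p → placement p q r ≡ chain r
  placement-before r<p = trans (insert-< (<-≤-trans r<p (≤-trans p≤q (n≤1+n q)))) (insert-< r<p)

  placement-zero : ∀ {r} → r ≡ p → placement p q r ≡ 0
  placement-zero r≡p = trans (insert-< (subst (_< suc q) (sym r≡p) (s≤s p≤q))) (insert-≡ r≡p)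

  placement-between : ∀ {r} → p < r → r ≤ q → placement p q r ≡ suc r
  placement-between {suc r} p<r r≤q = trans (insert-< (s≤s r≤q)) (insert-> p<r)

  placement-one : ∀ {r} → r ≡ suc q → placement p q r ≡ 1
  placement-one = insert-≡

  placement-after : ∀ {r} → suc q < r → placement p q r ≡ r
  placement-after {suc (suc r)} (s≤s (s≤s q<r)) = trans (insert-> (s≤s (s≤s q<r))) (insert-> (s≤s (≤-trans p≤q q<r)))

  data PlacementView (r : ℕ) : ℕ → Set where
    before  : r < p → PlacementView r (chain r)
    at-zero : r ≡ p → PlacementView r 0
    between : p < r → r ≤ q → PlacementView r (suc r)
    at-one  : r ≡ suc q → PlacementView r 1
    after   : suc q < r → PlacementView r r

  placement-view : ∀ r → PlacementView r (placement p q r)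
  placement-view r = by-cases (<-cmp r p) (<-cmp r (suc q))
    where
    by-cases : Tri (r < p) (r ≡ p) (p < r) → Tri (r < suc q) (r ≡ suc q) (suc q < r) →
               PlacementView r (placement p q r)
    by-cases (tri< r<p _ _) _ = subst (PlacementView r) (sym (placement-before r<p)) (before r<p)
    by-cases (tri≈ _ r≡p _) _ = subst (PlacementView r) (sym (placement-zero r≡p)) (at-zero r≡p)
    by-cases (tri> _ _ p<r) (tri< r<q+1 _ _) =
      subst (PlacementView r) (sym (placement-between p<r (s≤s⁻¹ r<q+1))) (between p<r (s≤s⁻¹ r<q+1))
    by-cases (tri> _ _ _) (tri≈ _ r≡q+1 _) = subst (PlacementView r) (sym (placement-one r≡q+1)) (at-one r≡q+1)
    by-cases (tri> _ _ _) (tri> _ _ q+1<r) = subst (PlacementView r) (sym (placement-after q+1<r)) (after q+1<r)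

  placement-zero⁻¹ : ∀ {r} → placement p q r ≡ 0 → r ≡ p
  placement-zero⁻¹ {r} eq with placement p q r | placement-view r | eq
  ... | _ | at-zero r≡p | _  = r≡p
  ... | _ | before _    | ()
  ... | _ | between _ _ | ()
  ... | _ | at-one _    | ()
  ... | _ | after ()    | refl

  placement-one⁻¹ : ∀ {r} → placement p q r ≡ 1 → r ≡ suc q
  placement-one⁻¹ {r} eq with placement p q r | placement-view r | eq
  ... | _ | at-one r≡q+1 | _   = r≡q+1
  ... | _ | before _     | ()
  ... | _ | at-zero _    | ()
  ... | _ | between () _ | refl
  ... | _ | after (s≤s ()) | refl

  placement-chain-monotone : ∀ {r′ r m′ m} → r′ < r → placement p q r′ ≡ chain m′ → placement p q r ≡ chain m → m′ < m
  placement-chain-monotone {r′} {r} r′<r eq′ eq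
    with placement p q r′ | placement-view r′ | eq′ | placement p q r | placement-view r | eq
  ... | _ | at-zero _ | () | _ | _ | _
  ... | _ | at-one _  | () | _ | _ | _
  ... | _ | _ | _ | _ | at-zero _ | ()
  ... | _ | _ | _ | _ | at-one _  | ()
  ... | _ | before _ | refl | _ | before _ | refl = r′<r
  ... | _ | before r′<p | refl | _ | between p<r _ | refl = <-≤-trans r′<p (s≤s⁻¹ p<r)
  ... | _ | before r′<p | refl | _ | after q+1<r | refl = <-≤-trans r′<p (≤-trans p≤q (s≤s⁻¹ (s≤s⁻¹ q+1<r)))
  ... | _ | between p<r′ _ | _ | _ | before r<p | _ = ⊥-elim (n≮n p (<-trans p<r′ (<-trans r′<r r<p)))
  ... | _ | between _ _ | refl | _ | between _ _ | refl = s≤s⁻¹ r′<r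
  ... | _ | between _ r′≤q | refl | _ | after q+1<r | refl = <-≤-trans r′≤q (s≤s⁻¹ (s≤s⁻¹ q+1<r))
  ... | _ | after q+1<r′ | _ | _ | before r<p | _ =
        ⊥-elim (n≮n p (<-trans (≤-<-trans p≤q (<-trans (n<1+n q) q+1<r′)) (<-trans r′<r r<p)))
  ... | _ | after q+1<r′ | _ | _ | between _ r≤q | _ =
        ⊥-elim (n≮n q (<-trans (<-trans (n<1+n q) q+1<r′) (<-≤-trans r′<r r≤q)))
  ... | _ | after _ | refl | _ | after _ | refl = s≤s⁻¹ (s≤s⁻¹ r′<r)

  placement-chain-reflects : ∀ {r′ r m′ m} → placement p q r′ ≡ chain m′ → placement p q r ≡ chain m → m′ < m → r′ < r
  placement-chain-reflects {r′} {r} eq′ eq m′<m with <-cmp r′ r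
  ... | tri< r′<r _ _ = r′<r
  ... | tri≈ _ refl _ = ⊥-elim (<-irrefl (suc-injective (suc-injective (trans (sym eq′) eq))) m′<m)
  ... | tri> _ _ r<r′ = ⊥-elim (<-asym m′<m (placement-chain-monotone r<r′ eq eq′))

  placement-chain-position : ∀ m → ∃[ r ] r ≤ chain m × placement p q r ≡ chain m
  placement-chain-position m with <-cmp m p | <-cmp m q
  ... | tri< m<p _ _ | _ = m , ≤-trans (n≤1+n m) (n≤1+n _) , placement-before m<p
  ... | tri≈ _ m≡p _ | tri< m<q _ _ = suc m , n≤1+n _ , placement-between (s≤s (≤-reflexive (sym m≡p))) m<q
  ... | tri> _ _ p<m | tri< m<q _ _ = suc m , n≤1+n _ , placement-between (<-trans p<m (n<1+n m)) m<q
  ... | _ | tri≈ _ m≡q _ = chain m , ≤-refl , placement-after (s≤s (s≤s (≤-reflexive (sym m≡q))))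
  ... | _ | tri> _ _ q<m = chain m , ≤-refl , placement-after (s≤s (<-trans q<m (n<1+n m)))

  placement-< : ∀ {c r} → q ≤ suc c → r < Size 1 1 c → placement p q r < Size 1 1 c
  placement-< {c} {r} q≤c+1 r<n with placement p q r | placement-view r
  ... | _ | before r<p    = s≤s (s≤s (≤-trans r<p (≤-trans p≤q q≤c+1)))
  ... | _ | at-zero _     = s≤s z≤n
  ... | _ | between _ r≤q = s≤s (s≤s (≤-trans r≤q q≤c+1))
  ... | _ | at-one _      = s≤s (s≤s z≤n)
  ... | _ | after _       = r<n

-- move c k is the move at positions k, k + 1 on states (p, q): it moves 0 or 1 past a neighbouring
-- chain label, these being the only incomparable adjacent pairs (move-swaps-placement).
module _ (c k p q : ℕ) where

  private
    select : Bool → Bool → Bool → Bool → ℕ × ℕ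
    select zero-right zero-left one-right one-left =
      if zero-right then (suc p , q) else
      if zero-left  then (k , q) else
      if one-right  then (p , suc q) else
      if one-left   then (p , pred q) else
      (p , q)

    zero-right? : Dec (k ≡ p × p < q)
    zero-right? = (k ℕ.≟ p) ×-dec (p ℕ.<? q)
    zero-left? : Dec (suc k ≡ p)
    zero-left? = suc k ℕ.≟ p
    one-right? : Dec (k ≡ suc q × q ≤ c)
    one-right? = (k ℕ.≟ suc q) ×-dec (q ℕ.≤? c)
    one-left? : Dec (k ≡ q × p < q × 1 < q)
    one-left? = (k ℕ.≟ q) ×-dec ((p ℕ.<? q) ×-dec (1 ℕ.<? q))

  move : ℕ × ℕ
  move = select (does zero-right?) (does zero-left?) (does one-right?) (does one-left?)

  data MoveView : ℕ × ℕ → Set where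
    zero-right : k ≡ p → p < q → MoveView (suc p , q)
    zero-left  : suc k ≡ p → MoveView (k , q)
    one-right  : ¬ (k ≡ p × p < q) → suc k ≢ p → k ≡ suc q → q ≤ c → MoveView (p , suc q)
    one-left   : k ≡ q → p < q → 1 < q → MoveView (p , pred q)
    stay       : ¬ (k ≡ p × p < q) → suc k ≢ p → ¬ (k ≡ suc q × q ≤ c) → ¬ (k ≡ q × p < q × 1 < q) →
                 MoveView (p , q)

  move-view : MoveView move
  move-view = view zero-right? zero-left? one-right? one-left?
    where
    view : (d₁ : Dec (k ≡ p × p < q)) (d₂ : Dec (suc k ≡ p)) (d₃ : Dec (k ≡ suc q × q ≤ c)) (d₄ : Dec (k ≡ q × p < q × 1 < q)) →
           MoveView (select (does d₁) (does d₂) (does d₃) (does d₄))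
    view (yes (k≡p , p<q)) _ _ _                          = zero-right k≡p p<q
    view (no ¬zr) (yes k+1≡p) _ _                        = zero-left k+1≡p
    view (no ¬zr) (no ¬zl) (yes (k≡q+1 , q≤c)) _          = one-right ¬zr ¬zl k≡q+1 q≤c
    view (no _) (no _) (no _) (yes (k≡q , p<q , 1<q))    = one-left k≡q p<q 1<q
    view (no ¬zr) (no ¬zl) (no ¬or) (no ¬ol)             = stay ¬zr ¬zl ¬or ¬ol

≢1+ : ∀ {m} → m ≢ suc m
≢1+ ()

module _ {c k p q : ℕ} where

  move-zero-right : k ≡ p → p < q → move c k p q ≡ (suc p , q)
  move-zero-right k≡p p<q with move c k p q | move-view c k p q
  ... | _ | zero-right _ _       = refl
  ... | _ | zero-left k+1≡p      = ⊥-elim (≢1+ (trans k≡p (sym k+1≡p)))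
  ... | _ | one-right ¬zr _ _ _  = ⊥-elim (¬zr (k≡p , p<q))
  ... | _ | one-left k≡q _ _     = ⊥-elim (<-irrefl (trans (sym k≡p) k≡q) p<q)
  ... | _ | stay ¬zr _ _ _       = ⊥-elim (¬zr (k≡p , p<q))

  move-zero-left : suc k ≡ p → p ≤ q → move c k p q ≡ (k , q)
  move-zero-left k+1≡p p≤q with move c k p q | move-view c k p q
  ... | _ | zero-right k≡p _     = ⊥-elim (≢1+ (trans k≡p (sym k+1≡p)))
  ... | _ | zero-left _          = refl
  ... | _ | one-right _ ¬zl _ _  = ⊥-elim (¬zl k+1≡p)
  ... | _ | one-left k≡q _ _     = ⊥-elim (n≮n q (subst (_≤ q) (trans (sym k+1≡p) (cong suc k≡q)) p≤q))
  ... | _ | stay _ ¬zl _ _       = ⊥-elim (¬zl k+1≡p)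

  move-one-right : k ≡ suc q → q ≤ c → p ≤ q → move c k p q ≡ (p , suc q)
  move-one-right k≡q+1 q≤c p≤q with move c k p q | move-view c k p q
  ... | _ | zero-right k≡p _     = ⊥-elim (n≮n q (subst (_≤ q) (trans (sym k≡p) k≡q+1) p≤q))
  ... | _ | zero-left k+1≡p      = ⊥-elim (n≮n q (<-trans (n<1+n q) (subst (_≤ q) (trans (sym k+1≡p) (cong suc k≡q+1)) p≤q)))
  ... | _ | one-right _ _ _ _    = refl
  ... | _ | one-left k≡q _ _     = ⊥-elim (≢1+ (trans (sym k≡q) k≡q+1))
  ... | _ | stay _ _ ¬or _       = ⊥-elim (¬or (k≡q+1 , q≤c))

  move-one-left : k ≡ q → p < q → 1 < q → move c k p q ≡ (p , pred q)
  move-one-left k≡q p<q 1<q with move c k p q | move-view c k p q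
  ... | _ | zero-right k≡p _     = ⊥-elim (<-irrefl (trans (sym k≡p) k≡q) p<q)
  ... | _ | zero-left k+1≡p      = ⊥-elim (<-asym p<q (subst (_< p) k≡q (subst (k <_) k+1≡p (n<1+n k))))
  ... | _ | one-right _ _ k≡q+1 _ = ⊥-elim (≢1+ (trans (sym k≡q) k≡q+1))
  ... | _ | one-left _ _ _       = refl
  ... | _ | stay _ _ _ ¬ol       = ⊥-elim (¬ol (k≡q , p<q , 1<q))

  move-stay : ¬ (k ≡ p × p < q) → suc k ≢ p → ¬ (k ≡ suc q × q ≤ c) → ¬ (k ≡ q × p < q × 1 < q) →
              move c k p q ≡ (p , q)
  move-stay ¬zr ¬zl ¬or ¬ol with move c k p q | move-view c k p q
  ... | _ | zero-right k≡p p<q        = ⊥-elim (¬zr (k≡p , p<q))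
  ... | _ | zero-left k+1≡p           = ⊥-elim (¬zl k+1≡p)
  ... | _ | one-right _ _ k≡q+1 q≤c   = ⊥-elim (¬or (k≡q+1 , q≤c))
  ... | _ | one-left k≡q p<q 1<q      = ⊥-elim (¬ol (k≡q , p<q , 1<q))
  ... | _ | stay _ _ _ _              = refl

-- placement p q is a linear extension of N_{1,1,c} iff Valid c p q: 0 and 2 must precede 1.
record Valid (c p q : ℕ) : Set where
  constructor valid
  field
    p≤q   : p ≤ q
    1≤q   : 1 ≤ q
    q≤1+c : q ≤ suc c

Valid-irrelevant : ∀ {c p q} (v w : Valid c p q) → v ≡ w
Valid-irrelevant (valid a b d) (valid a′ b′ d′)
  rewrite ≤-irrelevant a a′ | ≤-irrelevant b b′ | ≤-irrelevant d d′ = refl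

move-valid : ∀ {c k p q} → Valid c p q → Valid c (proj₁ (move c k p q)) (proj₂ (move c k p q))
move-valid {c} {k} {p} {q} (valid p≤q 1≤q q≤1+c) with move c k p q | move-view c k p q
... | _ | zero-right _ p<q            = valid p<q 1≤q q≤1+c
... | _ | zero-left refl              = valid (≤-trans (n≤1+n k) p≤q) 1≤q q≤1+c
... | _ | one-right _ _ _ q≤c         = valid (≤-trans p≤q (n≤1+n q)) (s≤s z≤n) (s≤s q≤c)
... | _ | one-left _ p<q (s≤s (s≤s _)) = valid (<⇒≤pred p<q) (s≤s z≤n) (≤-trans (n≤1+n _) q≤1+c)
... | _ | stay _ _ _ _                = valid p≤q 1≤q q≤1+c

move-involutive : ∀ {c k p q} → Valid c p q → uncurry (move c k) (move c k p q) ≡ (p , q)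
move-involutive {c} {k} {p} {q} (valid p≤q 1≤q q≤1+c) with move c k p q | move-view c k p q
... | _ | zero-right refl p<q   = move-zero-left {c} refl p<q
... | _ | zero-left refl        = move-zero-right {c} refl p≤q
... | _ | one-right _ _ refl _  = move-one-left {c} refl (s≤s p≤q) (s≤s 1≤q)
... | _ | one-left refl p<q 1<q = undo-one-left q refl p<q 1<q q≤1+c
  where
  undo-one-left : ∀ q′ → q′ ≡ k → p < q′ → 1 < q′ → q′ ≤ suc c → move c k p (pred q′) ≡ (p , q′)
  undo-one-left (suc q′) q′+1≡k p<q′+1 _ q′+1≤c+1 = move-one-right {c} (sym q′+1≡k) (s≤s⁻¹ q′+1≤c+1) (s≤s⁻¹ p<q′+1)
... | _ | stay ¬zr ¬zl ¬or ¬ol  = move-stay {c} ¬zr ¬zl ¬or ¬ol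

record State (c : ℕ) : Set where
  constructor state
  field
    p q     : ℕ
    isValid : Valid c p q

state-≡ : ∀ {c} {s t : State c} → State.p s ≡ State.p t → State.q s ≡ State.q t → s ≡ t
state-≡ {s = state p q v} {state _ _ w} refl refl = cong (state p q) (Valid-irrelevant v w)

_≟ₛ_ : ∀ {c} → DecidableEquality (State c)
s ≟ₛ t with State.p s ℕ.≟ State.p t | State.q s ℕ.≟ State.q t
... | yes p≡ | yes q≡ = yes (state-≡ p≡ q≡)
... | no p≢ | _       = no (p≢ ∘ cong State.p)
... | _     | no q≢   = no (q≢ ∘ cong State.q)

moveState : ∀ {c} → ℕ → State c → State c
moveState {c} k (state p q v) = state (proj₁ (move c k p q)) (proj₂ (move c k p q)) (move-valid {c} {k} v)

moveState-involutive : ∀ {c} k (s : State c) → moveState k (moveState k s) ≡ s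
moveState-involutive {c} k (state p q v) =
  state-≡ (cong proj₁ (move-involutive {c} {k} v)) (cong proj₂ (move-involutive {c} {k} v))

module _ {c : ℕ} where

  encode : State c → Vec (Fin (Size 1 1 c)) (Size 1 1 c)
  encode (state p q (valid p≤q _ q≤1+c)) = tabulate λ r → fromℕ< (placement-< p≤q q≤1+c (toℕ<n r))

  toℕ-lookup-encode : ∀ s r → toℕ (lookup (encode s) r) ≡ placement (State.p s) (State.q s) (toℕ r)
  toℕ-lookup-encode (state p q (valid p≤q _ q≤1+c)) r =
    trans (cong toℕ (lookup∘tabulate (λ r → fromℕ< (placement-< p≤q q≤1+c (toℕ<n r))) r))
          (toℕ-fromℕ< (placement-< p≤q q≤1+c (toℕ<n r)))

data ≺-Cases : ℕ → ℕ → Set where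
  zero≺one  : ≺-Cases 0 1
  two≺one   : ≺-Cases 2 1
  chain≺chain : ∀ {j l} → j < l → ≺-Cases (chain j) (chain l)

≺-cases : ∀ {x y} → T (x ≺ y) → ≺-Cases x y
≺-cases {zero}           {suc zero}    _ = zero≺one
≺-cases {suc (suc j)}    {suc (suc l)} t = chain≺chain (<ᵇ⇒< j l t)
≺-cases {suc (suc zero)} {suc zero}    _ = two≺one

module _ {p q : ℕ} (p≤q : p ≤ q) (1≤q : 1 ≤ q) where

  placement-≺ : ∀ {r r′} → T (placement p q r ≺ placement p q r′) → r < r′
  placement-≺ {r} {r′} t = by-cases (≺-cases t) refl refl
    where
    by-cases : ∀ {x y} → ≺-Cases x y → placement p q r ≡ x → placement p q r′ ≡ y → r < r′
    by-cases zero≺one eq eq′ =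
      subst₂ _<_ (sym (placement-zero⁻¹ p≤q eq)) (sym (placement-one⁻¹ p≤q eq′)) (s≤s p≤q)
    by-cases two≺one eq eq′ = subst (r <_) (sym (placement-one⁻¹ p≤q eq′)) (two-before-one eq)
      where
      two-before-one : placement p q r ≡ 2 → r < suc q
      two-before-one eq with placement p q r | placement-view p≤q r | eq
      ... | _ | before r<p    | _    = <-≤-trans r<p (≤-trans p≤q (n≤1+n q))
      ... | _ | between _ r≤q | _    = s≤s r≤q
      ... | _ | after q+1<r   | refl = ⊥-elim (<⇒≱ q+1<r (s≤s 1≤q))
    by-cases (chain≺chain j<l) eq eq′ = placement-chain-reflects p≤q eq eq′ j<l

module _ {c : ℕ} where

  placement-position : ∀ {p q} → Valid c p q → ∀ ℓ → ℓ < Size 1 1 c →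
                       ∃[ r ] r < Size 1 1 c × placement p q r ≡ ℓ
  placement-position {p} {q} (valid p≤q _ q≤1+c) zero _ =
    p , s≤s (≤-trans p≤q (≤-trans q≤1+c (n≤1+n _))) , placement-zero p≤q refl
  placement-position {p} {q} (valid p≤q _ q≤1+c) (suc zero) _ =
    suc q , s≤s (s≤s q≤1+c) , placement-one p≤q refl
  placement-position (valid p≤q _ _) (suc (suc m)) ℓ<n with placement-chain-position p≤q m
  ... | r , r≤ℓ , eq = r , ≤-<-trans r≤ℓ ℓ<n , eq

  encodeLE : State c → LinExt 1 1 c
  encodeLE s@(state p q v@(valid p≤q 1≤q _)) = record { list = encode s ; all = complete ; order = ordered }
    where
    complete : ∀ x → x Vec.∈ encode s
    complete x with placement-position v (toℕ x) (toℕ<n x)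
    ... | r , r<n , eq = subst (Vec._∈ encode s) lookup≡x (∈-lookup (fromℕ< r<n) (encode s))
      where
      lookup≡x : lookup (encode s) (fromℕ< r<n) ≡ x
      lookup≡x = Fin.toℕ-injective (trans (toℕ-lookup-encode s (fromℕ< r<n))
                                    (trans (cong (placement p q) (toℕ-fromℕ< r<n)) eq))
    ordered : ∀ i j → T (ltN 1 1 c (lookup (encode s) i) (lookup (encode s) j)) → toℕ i < toℕ j
    ordered i j t = placement-≺ p≤q 1≤q (subst T
      (trans (ltN-≺ (lookup (encode s) i) (lookup (encode s) j))
             (cong₂ _≺_ (toℕ-lookup-encode s i) (toℕ-lookup-encode s j))) t)

  encode-injective : Injective _≡_ _≡_ encode
  encode-injective {s@(state p q (valid p≤q _ q≤1+c))} {t@(state p′ q′ (valid p′≤q′ _ _))} eq =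
    state-≡ (placement-zero⁻¹ p′≤q′ (label-at p<n (placement-zero p≤q refl)))
            (suc-injective (placement-one⁻¹ p′≤q′ (label-at q+1<n (placement-one p≤q refl))))
    where
    p<n : p < Size 1 1 c
    p<n = s≤s (≤-trans p≤q (≤-trans q≤1+c (n≤1+n _)))
    q+1<n : suc q < Size 1 1 c
    q+1<n = s≤s (s≤s q≤1+c)
    label-at : ∀ {r ℓ} (r<n : r < Size 1 1 c) → placement p q r ≡ ℓ → placement p′ q′ r ≡ ℓ
    label-at {r} {ℓ} r<n eq′ = begin
      placement p′ q′ r                        ≡⟨ cong (placement p′ q′) (toℕ-fromℕ< r<n) ⟨
      placement p′ q′ (toℕ (fromℕ< r<n))       ≡⟨ toℕ-lookup-encode t (fromℕ< r<n) ⟨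
      toℕ (lookup (encode t) (fromℕ< r<n))     ≡⟨ cong (λ v → toℕ (lookup v (fromℕ< r<n))) eq ⟨
      toℕ (lookup (encode s) (fromℕ< r<n))     ≡⟨ toℕ-lookup-encode s (fromℕ< r<n) ⟩
      placement p q (toℕ (fromℕ< r<n))         ≡⟨ cong (placement p q) (toℕ-fromℕ< r<n) ⟩
      placement p q r                          ≡⟨ eq′ ⟩
      ℓ                                        ∎
      where open ≡-Reasoning

comparable≺ : ℕ → ℕ → Bool
comparable≺ x y = x ≺ y ∨ y ≺ x

chain-comparable : ∀ m → comparable≺ (chain m) (chain (suc m)) ≡ true
chain-comparable m = cong (_∨ (chain (suc m) ≺ chain m)) (Equivalence.to T-≡ (<⇒<ᵇ (n<1+n m)))

module _ {c k p q : ℕ} (v : Valid c p q) where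
  open Valid v

  stay-comparable : k < suc (suc c) → ¬ (k ≡ p × p < q) → suc k ≢ p → ¬ (k ≡ suc q × q ≤ c) →
                    ¬ (k ≡ q × p < q × 1 < q) → comparable≺ (placement p q k) (placement p q (suc k)) ≡ true
  stay-comparable k<c+2 ¬zr ¬zl ¬or ¬ol with placement p q k | placement-view p≤q k
  ... | _ | before k<p = trans (cong (comparable≺ (chain k)) (placement-before p≤q k+1<p)) (chain-comparable k)
    where
    k+1<p : suc k < p
    k+1<p = ≤∧≢⇒< k<p ¬zl
  ... | _ | at-zero k≡p with m≤n⇒m<n∨m≡n p≤q
  ...   | inj₁ p<q = ⊥-elim (¬zr (k≡p , p<q))
  ...   | inj₂ p≡q = cong (comparable≺ 0) (placement-one p≤q (cong suc (trans k≡p p≡q)))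
  stay-comparable k<c+2 ¬zr ¬zl ¬or ¬ol | _ | between p<k k≤q with m≤n⇒m<n∨m≡n k≤q
  ...   | inj₁ k<q = trans (cong (comparable≺ (suc k)) (placement-between p≤q (<-trans p<k (n<1+n k)) k<q))
                           (successor-comparable p<k)
    where
    successor-comparable : ∀ {k} → p < k → comparable≺ (suc k) (suc (suc k)) ≡ true
    successor-comparable {suc k} _ = chain-comparable k
  ...   | inj₂ k≡q with m≤n⇒m<n∨m≡n 1≤q
  ...     | inj₁ 1<q = ⊥-elim (¬ol (k≡q , subst (p <_) k≡q p<k , 1<q))
  ...     | inj₂ 1≡q = subst (λ m → comparable≺ (suc m) (placement p q (suc m)) ≡ true) (sym k≡1)
                         (cong (comparable≺ 2) (placement-one p≤q (cong suc 1≡q)))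
    where
    k≡1 : k ≡ 1
    k≡1 = trans k≡q (sym 1≡q)
  stay-comparable k<c+2 ¬zr ¬zl ¬or ¬ol | _ | at-one k≡q+1 with m≤n⇒m<n∨m≡n q≤1+c
  ... | inj₁ q<c+1 = ⊥-elim (¬or (k≡q+1 , s≤s⁻¹ q<c+1))
  ... | inj₂ q≡c+1 = ⊥-elim (<-irrefl (trans k≡q+1 (cong suc q≡c+1)) k<c+2)
  stay-comparable k<c+2 ¬zr ¬zl ¬or ¬ol | _ | after q+1<k =
    trans (cong (comparable≺ k) (placement-after p≤q (<-trans q+1<k (n<1+n k)))) (successor-comparable q+1<k)
    where
    successor-comparable : ∀ {k} → suc q < k → comparable≺ k (suc k) ≡ true
    successor-comparable {suc zero}    (s≤s ())
    successor-comparable {suc (suc k)} _ = chain-comparable k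

  move-swaps-placement : k < suc (suc c) →
    (comparable≺ (placement p q k) (placement p q (suc k)) ≡ false ×
       uncurry placement (move c k p q) ≗ placement p q ∘ swap k)
    ⊎ (comparable≺ (placement p q k) (placement p q (suc k)) ≡ true × move c k p q ≡ (p , q))
  move-swaps-placement k<c+2 with move c k p q | move-view c k p q
  ... | _ | zero-right refl p<q = inj₁ (incomparable , placement-move-zero p<q)
    where
    incomparable : comparable≺ (placement p q k) (placement p q (suc k)) ≡ false
    incomparable rewrite placement-zero p≤q {k} refl | placement-between p≤q (n<1+n k) p<q = refl
  ... | _ | zero-left refl = inj₁ (incomparable , λ r → sym (begin
    placement (suc k) q (swap k r)     ≡⟨ placement-move-zero p≤q (swap k r) ⟩
    placement k q (swap k (swap k r))  ≡⟨ cong (placement k q) (swap-involutive k r) ⟩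
    placement k q r                    ∎))
    where
    open ≡-Reasoning
    incomparable : comparable≺ (placement p q k) (placement p q (suc k)) ≡ false
    incomparable rewrite placement-before p≤q (n<1+n k) | placement-zero p≤q {suc k} refl = refl
  ... | _ | one-right _ _ refl _ = inj₁ (incomparable , placement-move-one p q)
    where
    one-vs-chain : ∀ {m} → 1 ≤ m → comparable≺ 1 (chain m) ≡ false
    one-vs-chain {suc m} _ = refl
    incomparable : comparable≺ (placement p q (suc q)) (placement p q (suc (suc q))) ≡ false
    incomparable rewrite placement-one p≤q {suc q} refl | placement-after p≤q (n<1+n (suc q)) = one-vs-chain 1≤q
  ... | _ | one-left refl p<q 1<q = inj₁ (incomparable , undo-move-one 1<q)
    where
    chain-vs-one : ∀ {m} → 1 < m → comparable≺ (suc m) 1 ≡ false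
    chain-vs-one {suc zero}    (s≤s ())
    chain-vs-one {suc (suc m)} _ = refl
    incomparable : comparable≺ (placement p k k) (placement p k (suc k)) ≡ false
    incomparable rewrite placement-between p≤q p<q (≤-refl {k}) | placement-one p≤q {suc k} refl = chain-vs-one 1<q
    undo-move-one : ∀ {q} → 1 < q → placement p (pred q) ≗ placement p q ∘ swap q
    undo-move-one {suc q} _ r = sym (begin
      placement p (suc q) (swap (suc q) r)          ≡⟨ placement-move-one p q (swap (suc q) r) ⟩
      placement p q (swap (suc q) (swap (suc q) r)) ≡⟨ cong (placement p q) (swap-involutive (suc q) r) ⟩
      placement p q r                               ∎)
      where open ≡-Reasoning
  ... | _ | stay ¬zr ¬zl ¬or ¬ol = inj₂ (stay-comparable k<c+2 ¬zr ¬zl ¬or ¬ol , refl)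

toℕ-transpose-adjacent : ∀ {n} (i : Fin n) j →
  toℕ (Transposition.transpose Fin._≟_ (inject₁ i) (fsuc i) j) ≡ swap (toℕ i) (toℕ j)
toℕ-transpose-adjacent i j =
  trans (transpose-natural Fin._≟_ ℕ._≟_ toℕ Fin.toℕ-injective (inject₁ i) (fsuc i) j)
        (cong (λ m → ℕ-Transposition.transpose m (suc (toℕ i)) (toℕ j)) (toℕ-inject₁ i))

module _ {c : ℕ} where

  bk-encode : ∀ i (s : State c) → bk 1 1 c i (encode s) ≡ encode (moveState (toℕ i) s)
  bk-encode i s@(state p q v) = by-cases (move-swaps-placement {k = toℕ i} v (toℕ<n i))
    where
    open ≡-Reasoning
    open Transposition (Fin._≟_ {Size 1 1 c})
    k : ℕ
    k = toℕ i
    comparable-labels : comparableN 1 1 c (lookup (encode s) (inject₁ i)) (lookup (encode s) (fsuc i))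
                        ≡ comparable≺ (placement p q k) (placement p q (suc k))
    comparable-labels = cong₂ _∨_ (trans (ltN-≺ x y) (cong₂ _≺_ x≡ y≡)) (trans (ltN-≺ y x) (cong₂ _≺_ y≡ x≡))
      where
      x y : Fin (Size 1 1 c)
      x = lookup (encode s) (inject₁ i)
      y = lookup (encode s) (fsuc i)
      x≡ : toℕ x ≡ placement p q k
      x≡ = trans (toℕ-lookup-encode s (inject₁ i)) (cong (placement p q) (toℕ-inject₁ i))
      y≡ : toℕ y ≡ placement p q (suc k)
      y≡ = toℕ-lookup-encode s (fsuc i)
    by-cases : (comparable≺ (placement p q k) (placement p q (suc k)) ≡ false ×
                  uncurry placement (move c k p q) ≗ placement p q ∘ swap k)
               ⊎ (comparable≺ (placement p q k) (placement p q (suc k)) ≡ true × move c k p q ≡ (p , q)) →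
               bk 1 1 c i (encode s) ≡ encode (moveState k s)
    by-cases (inj₁ (incomparable , shifted)) = lookup-extensionality λ j → Fin.toℕ-injective (begin
      toℕ (lookup (bk 1 1 c i (encode s)) j)
        ≡⟨ cong toℕ (lookup-bk-incomparable {1} {1} {c} i (encode s) (trans comparable-labels incomparable) j) ⟩
      toℕ (lookup (encode s) (transpose (inject₁ i) (fsuc i) j))
        ≡⟨ toℕ-lookup-encode s (transpose (inject₁ i) (fsuc i) j) ⟩
      placement p q (toℕ (transpose (inject₁ i) (fsuc i) j))
        ≡⟨ cong (placement p q) (toℕ-transpose-adjacent i j) ⟩
      placement p q (swap k (toℕ j))
        ≡⟨ shifted (toℕ j) ⟨
      uncurry placement (move c k p q) (toℕ j)
        ≡⟨ toℕ-lookup-encode (moveState k s) j ⟨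
      toℕ (lookup (encode (moveState k s)) j)
        ∎)
    by-cases (inj₂ (comparable , stays)) =
      trans (bk-comparable {1} {1} {c} i (encode s) (trans comparable-labels comparable))
            (cong encode (sym (state-≡ {s = moveState k s} {t = s} (cong proj₁ stays) (cong proj₂ stays))))

module Decode {c : ℕ} (L : LinExt 1 1 c) where

  private
    n : ℕ
    n = Size 1 1 c
    v : Vec (Fin n) n
    v = list L

  open CompleteVector v (LinExt.all L)

  label : Fin n → ℕ
  label r = toℕ (lookup v r)

  position-≺ : ∀ {x y} → T (toℕ x ≺ toℕ y) → toℕ (position x) < toℕ (position y)
  position-≺ {x} {y} t = LinExt.order L (position x) (position y)
    (subst T (sym (trans (ltN-≺ (lookup v (position x)) (lookup v (position y)))
                         (cong₂ (λ a b → toℕ a ≺ toℕ b) (lookup-position x) (lookup-position y)))) t)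

  p q : ℕ
  p = toℕ (position fzero)
  q = pred (toℕ (position (fsuc fzero)))

  private
    zero-before-one : toℕ (position fzero) < toℕ (position (fsuc fzero))
    zero-before-one = position-≺ {fzero} {fsuc fzero} _
    two-before-one : toℕ (position (fsuc (fsuc fzero))) < toℕ (position (fsuc fzero))
    two-before-one = position-≺ {fsuc (fsuc fzero)} {fsuc fzero} _

  position-one : toℕ (position (fsuc fzero)) ≡ suc q
  position-one = suc-pred zero-before-one
    where
    suc-pred : ∀ {m n} → m < n → n ≡ suc (pred n)
    suc-pred {n = suc n} _ = refl

  q≢0 : q ≢ 0
  q≢0 q≡0 = 0≢2 (begin
    fzero                                    ≡⟨ lookup-position fzero ⟨
    lookup v (position fzero)                ≡⟨ cong (lookup v) (Fin.toℕ-injective (trans p≡0 (sym p₂≡0))) ⟩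
    lookup v (position (fsuc (fsuc fzero)))  ≡⟨ lookup-position (fsuc (fsuc fzero)) ⟩
    fsuc (fsuc fzero)                        ∎)
    where
    open ≡-Reasoning
    0≢2 : fzero {suc (suc c)} ≢ fsuc (fsuc fzero)
    0≢2 ()
    one-at-1 : toℕ (position (fsuc fzero)) ≡ 1
    one-at-1 = trans position-one (cong suc q≡0)
    p≡0 : toℕ (position fzero) ≡ 0
    p≡0 = n<1⇒n≡0 (subst (toℕ (position fzero) <_) one-at-1 zero-before-one)
    p₂≡0 : toℕ (position (fsuc (fsuc fzero))) ≡ 0
    p₂≡0 = n<1⇒n≡0 (subst (toℕ (position (fsuc (fsuc fzero))) <_) one-at-1 two-before-one)

  valid-positions : Valid c p q
  valid-positions = valid (s≤s⁻¹ (subst (p <_) position-one zero-before-one)) (n≢0⇒n>0 q≢0)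
    (s≤s⁻¹ (s≤s⁻¹ (subst (_< n) position-one (toℕ<n (position (fsuc fzero))))))

  decode : State c
  decode = state p q valid-positions

  Agrees : Fin n → Set
  Agrees r = label r ≡ placement p q (toℕ r)

  private
    p≤q : p ≤ q
    p≤q = Valid.p≤q valid-positions

    -- A smaller chain label at r would also sit at an earlier chain position; a larger one would
    -- force chain M to an earlier position, where placement is smaller than chain M.
    smaller-label-impossible : ∀ r {m M} → label r ≡ chain m → placement p q (toℕ r) ≡ chain M →
                               (∀ {r′} → toℕ r′ < toℕ r → Agrees r′) → ¬ m < M
    smaller-label-impossible r {m} {M} label-r eq IH m<M = <-irrefl (cong toℕ r′≡r) r′<r
      where
      earlier : ∃[ r ] r ≤ chain m × placement p q r ≡ chain m
      earlier = placement-chain-position p≤q m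
      r₀ : ℕ
      r₀ = proj₁ earlier
      r₀<n : r₀ < n
      r₀<n = ≤-<-trans (proj₁ (proj₂ earlier)) (subst (_< n) label-r (toℕ<n (lookup v r)))
      r′ : Fin n
      r′ = fromℕ< r₀<n
      r′<r : toℕ r′ < toℕ r
      r′<r = subst (_< toℕ r) (sym (toℕ-fromℕ< r₀<n))
               (placement-chain-reflects p≤q (proj₂ (proj₂ earlier)) eq m<M)
      r′≡r : r′ ≡ r
      r′≡r = lookup-injective (Fin.toℕ-injective (begin
        label r′                 ≡⟨ IH r′<r ⟩
        placement p q (toℕ r′)   ≡⟨ cong (placement p q) (toℕ-fromℕ< r₀<n) ⟩
        placement p q r₀         ≡⟨ proj₂ (proj₂ earlier) ⟩
        chain m                  ≡⟨ label-r ⟨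
        label r                  ∎))
        where open ≡-Reasoning

    larger-label-impossible : ∀ r {m M} → label r ≡ chain m → placement p q (toℕ r) ≡ chain M →
                              (∀ {r′} → toℕ r′ < toℕ r → Agrees r′) → ¬ M < m
    larger-label-impossible r {m} {M} label-r eq IH M<m =
      <-irrefl refl (placement-chain-monotone p≤q r″<r (trans (sym (IH r″<r)) label-r″) eq)
      where
      chainM<n : chain M < n
      chainM<n = subst (_< n) eq (placement-< p≤q (Valid.q≤1+c valid-positions) (toℕ<n r))
      x r″ : Fin n
      x = fromℕ< chainM<n
      r″ = position x
      label-r″ : label r″ ≡ chain M
      label-r″ = trans (cong toℕ (lookup-position x)) (toℕ-fromℕ< chainM<n)
      r″<r : toℕ r″ < toℕ r
      r″<r = subst (λ y → toℕ r″ < toℕ y) (position-lookup r)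
               (position-≺ {x} {lookup v r} (subst₂ (λ ℓ ℓ′ → T (ℓ ≺ ℓ′)) (sym (toℕ-fromℕ< chainM<n)) (sym label-r) (<⇒<ᵇ M<m)))

    label-at-chain-position : ∀ r M → placement p q (toℕ r) ≡ chain M →
                              (∀ {r′} → toℕ r′ < toℕ r → Agrees r′) → label r ≡ chain M
    label-at-chain-position r M eq IH with lookup v r in at-r
    ... | fzero = ⊥-elim (0≢chain (trans (sym (placement-zero p≤q (cong toℕ r≡))) eq))
      where
      r≡ : r ≡ position fzero
      r≡ = trans (sym (position-lookup r)) (cong position at-r)
      0≢chain : 0 ≢ chain M
      0≢chain ()
    ... | fsuc fzero = ⊥-elim (1≢chain (trans (sym (placement-one p≤q (trans (cong toℕ r≡) position-one))) eq))
      where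
      r≡ : r ≡ position (fsuc fzero)
      r≡ = trans (sym (position-lookup r)) (cong position at-r)
      1≢chain : 1 ≢ chain M
      1≢chain ()
    ... | fsuc (fsuc m) with <-cmp (toℕ m) M
    ...   | tri≈ _ m≡M _ = cong chain m≡M
    ...   | tri< m<M _ _ = ⊥-elim (smaller-label-impossible r (cong toℕ at-r) eq IH m<M)
    ...   | tri> _ _ M<m = ⊥-elim (larger-label-impossible r (cong toℕ at-r) eq IH M<m)

  label-placement : ∀ r → Agrees r
  label-placement = All.wfRec Fin.<-wellFounded 0ℓ Agrees step
    where
    step : ∀ r → (∀ {r′} → toℕ r′ < toℕ r → Agrees r′) → Agrees r
    step r IH = by-view (placement-view p≤q (toℕ r)) refl
      where
      via-chain : ∀ M → placement p q (toℕ r) ≡ chain M → label r ≡ placement p q (toℕ r)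
      via-chain M eq = trans (label-at-chain-position r M eq IH) (sym eq)
      by-view : ∀ {ℓ} → PlacementView p≤q (toℕ r) ℓ → ℓ ≡ placement p q (toℕ r) → label r ≡ placement p q (toℕ r)
      by-view (before _) eq = via-chain (toℕ r) (sym eq)
      by-view (at-zero r≡p) eq =
        trans (cong label (Fin.toℕ-injective r≡p)) (trans (cong toℕ (lookup-position fzero)) eq)
      by-view (between p<r _) eq = via-chain (pred (toℕ r)) (trans (sym eq) (cong suc (suc-pred p<r)))
        where
        suc-pred : ∀ {m} → p < m → m ≡ suc (pred m)
        suc-pred {suc m} _ = refl
      by-view (at-one r≡q+1) eq =
        trans (cong label (Fin.toℕ-injective (trans r≡q+1 (sym position-one))))
              (trans (cong toℕ (lookup-position (fsuc fzero))) eq)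
      by-view (after q+1<r) eq = via-chain (pred (pred (toℕ r))) (trans (sym eq) (suc-suc-pred-pred q+1<r))
        where
        suc-suc-pred-pred : ∀ {m} → suc q < m → m ≡ chain (pred (pred m))
        suc-suc-pred-pred {suc zero}    (s≤s ())
        suc-suc-pred-pred {suc (suc m)} _ = refl

  encode-decode : encode decode ≡ list L
  encode-decode = lookup-extensionality λ r →
    Fin.toℕ-injective (trans (toℕ-lookup-encode decode r) (sym (label-placement r)))

module _ {c : ℕ} where

  linear-extensions↔states : Inverse (LESetoid 1 1 c) (setoid (State c))
  linear-extensions↔states = record
    { to        = Decode.decode
    ; from      = encodeLE
    ; to-cong   = λ {L} {L′} eq → encode-injective (trans (Decode.encode-decode L) (trans eq (sym (Decode.encode-decode L′))))
    ; from-cong = cong encode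
    ; inverse   = (λ {s} {L} eq → encode-injective (trans (Decode.encode-decode L) eq))
                , (λ {L} {s} eq → trans (cong encode eq) (Decode.encode-decode L))
    }

-- The Bender–Knuth group of N_{1,1,c}

valid? : ∀ c p q → Dec (Valid c p q)
valid? c p q with p ℕ.≤? q | 1 ℕ.≤? q | q ℕ.≤? suc c
... | yes p≤q | yes 1≤q | yes q≤c+1 = yes (valid p≤q 1≤q q≤c+1)
... | no p≰q  | _       | _         = no (p≰q ∘ Valid.p≤q)
... | yes _   | no 1≰q  | _         = no (1≰q ∘ Valid.1≤q)
... | yes _   | yes _   | no q≰c+1  = no (q≰c+1 ∘ Valid.q≤1+c)

state-candidates : ∀ c → ℕ × ℕ → List (State c)
state-candidates c (p , q) with valid? c p q
... | yes v = state p q v ∷ []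
... | no _  = []

states : ∀ c → List (State c)
states c = concatMap (state-candidates c) (cartesianProduct (upTo (suc (suc c))) (upTo (suc (suc c))))

∈-states : ∀ {c} (s : State c) → s ∈ states c
∈-states {c} s@(state p q v@(valid p≤q _ q≤c+1)) = ∈-concatMap⁺ (state-candidates c)
  (List.lose (∈-cartesianProduct⁺ (∈-upTo⁺ (s≤s (≤-trans p≤q q≤c+1))) (∈-upTo⁺ (s≤s q≤c+1))) candidate)
  where
  candidate : s ∈ state-candidates c (p , q)
  candidate with valid? c p q
  ... | yes v′ = here (state-≡ refl refl)
  ... | no ¬v  = ⊥-elim (¬v v)

-- c ≥ 1 provides the moves t₁, t₂, t₃ needed at the base state.
module Generation₁₁ (c′ : ℕ) where

  private
    c : ℕ
    c = suc c′
    I : Set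
    I = Fin (suc (suc c))

  generator : I → State c → State c
  generator i = moveState (toℕ i)

  open Generation _≟ₛ_ generator

  moves : List I → ℕ × ℕ → ℕ × ℕ
  moves []      = id
  moves (i ∷ w) = uncurry (move c (toℕ i)) ∘ moves w

  act-moves : ∀ w s → (State.p (act w s) , State.q (act w s)) ≡ moves w (State.p s , State.q s)
  act-moves []      s = refl
  act-moves (i ∷ w) s = cong (uncurry (move c (toℕ i))) (act-moves w s)

  moves-++ : ∀ u w → moves (u ++ w) ≗ moves u ∘ moves w
  moves-++ []      w s = refl
  moves-++ (i ∷ u) w s = cong (uncurry (move c (toℕ i))) (moves-++ u w s)

  base : State c
  base = state 0 1 (valid z≤n ≤-refl (s≤s z≤n))

  raise-one : ∀ q → 1 ≤ q → q ≤ suc c → ∃[ w ] moves w (0 , 1) ≡ (0 , q)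
  raise-one (suc zero)    _ _       = [] , refl
  raise-one (suc (suc q)) _ q+2≤c+1 with raise-one (suc q) (s≤s z≤n) (≤-trans (n≤1+n _) q+2≤c+1)
  ... | w , reached = fromℕ< (s≤s q+2≤c+1) ∷ w , (begin
    uncurry (move c (toℕ (fromℕ< (s≤s q+2≤c+1)))) (moves w (0 , 1))  ≡⟨ cong₂ (uncurry ∘ move c) (toℕ-fromℕ< (s≤s q+2≤c+1)) reached ⟩
    move c (suc (suc q)) 0 (suc q)                                   ≡⟨ move-one-right {c} refl (s≤s⁻¹ q+2≤c+1) z≤n ⟩
    (0 , suc (suc q))                                                ∎)
    where open ≡-Reasoning

  raise-zero : ∀ p q → p ≤ q → q ≤ suc c → ∃[ w ] moves w (0 , q) ≡ (p , q)
  raise-zero zero    q _ _ = [] , refl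
  raise-zero (suc p) q p+1≤q q≤c+1 with raise-zero p q (≤-trans (n≤1+n p) p+1≤q) q≤c+1
  ... | w , reached = fromℕ< p<c+2 ∷ w , (begin
    uncurry (move c (toℕ (fromℕ< p<c+2))) (moves w (0 , q))  ≡⟨ cong₂ (uncurry ∘ move c) (toℕ-fromℕ< p<c+2) reached ⟩
    move c p p q                                             ≡⟨ move-zero-right {c} refl p+1≤q ⟩
    (suc p , q)                                              ∎)
    where
    open ≡-Reasoning
    p<c+2 : p < suc (suc c)
    p<c+2 = ≤-trans p+1≤q (≤-trans q≤c+1 (n≤1+n _))

  connected : ∀ s → ∃[ w ] act w base ≡ s
  connected (state p q (valid p≤q 1≤q q≤c+1)) with raise-one q 1≤q q≤c+1 | raise-zero p q p≤q q≤c+1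
  ... | w₁ , reached₁ | w₂ , reached₂ = w₂ ++ w₁ , state-≡ (cong proj₁ reached) (cong proj₂ reached)
    where
    reached : (State.p (act (w₂ ++ w₁) base) , State.q (act (w₂ ++ w₁) base)) ≡ (p , q)
    reached = trans (act-moves (w₂ ++ w₁) base) (trans (moves-++ w₂ w₁ (0 , 1)) (trans (cong (moves w₂) reached₁) reached₂))

  private
    g₀ g₁ g₂ : I
    g₀ = fzero
    g₁ = fsuc fzero
    g₂ = fsuc (fsuc fzero)

  -- (t₁t₂)³ and (t₂t₃)³ swap the base state with its image under t₁, resp. t₃, and fix all
  -- other states, which is checked by evaluation.
  braid₀₁ braid₁₂ : List I
  braid₀₁ = g₀ ∷ g₁ ∷ g₀ ∷ g₁ ∷ g₀ ∷ g₁ ∷ []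
  braid₁₂ = g₁ ∷ g₂ ∷ g₁ ∷ g₂ ∷ g₁ ∷ g₂ ∷ []

  braid₀₁-fixes : ∀ {p q} → Valid c p q → (p , q) ≢ (0 , 1) → (p , q) ≢ (1 , 1) → moves braid₀₁ (p , q) ≡ (p , q)
  braid₀₁-fixes {zero}          {zero}          (valid _ () _)
  braid₀₁-fixes {zero}          {suc zero}      _ ≢base _ = ⊥-elim (≢base refl)
  braid₀₁-fixes {zero}          {suc (suc q)}   _ _ _ = refl
  braid₀₁-fixes {suc zero}      {zero}          (valid () _ _)
  braid₀₁-fixes {suc zero}      {suc zero}      _ _ ≢other = ⊥-elim (≢other refl)
  braid₀₁-fixes {suc zero}      {suc (suc q)}   _ _ _ = refl
  braid₀₁-fixes {suc (suc p)}   {zero}          (valid () _ _)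
  braid₀₁-fixes {suc (suc p)}   {suc zero}      (valid (s≤s ()) _ _)
  braid₀₁-fixes {suc (suc zero)} {suc (suc q)}  _ _ _ = refl
  braid₀₁-fixes {suc (suc (suc p))} {suc (suc zero)} (valid (s≤s (s≤s ())) _ _)
  braid₀₁-fixes {suc (suc (suc p))} {suc (suc (suc q))} _ _ _ = refl

  braid₁₂-fixes : ∀ {p q} → Valid c p q → (p , q) ≢ (0 , 1) → (p , q) ≢ (0 , 2) → moves braid₁₂ (p , q) ≡ (p , q)
  braid₁₂-fixes {zero}          {zero}            (valid _ () _)
  braid₁₂-fixes {zero}          {suc zero}        _ ≢base _ = ⊥-elim (≢base refl)
  braid₁₂-fixes {zero}          {suc (suc zero)}  _ _ ≢other = ⊥-elim (≢other refl)
  braid₁₂-fixes {zero}          {suc (suc (suc q))} _ _ _ = refl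
  braid₁₂-fixes {suc zero}      {zero}            (valid () _ _)
  braid₁₂-fixes {suc zero}      {suc zero}        _ _ _ = refl
  braid₁₂-fixes {suc zero}      {suc (suc zero)}  _ _ _ = refl
  braid₁₂-fixes {suc zero}      {suc (suc (suc q))} _ _ _ = refl
  braid₁₂-fixes {suc (suc p)}   {zero}            (valid () _ _)
  braid₁₂-fixes {suc (suc p)}   {suc zero}        (valid (s≤s ()) _ _)
  braid₁₂-fixes {suc (suc zero)} {suc (suc zero)} _ _ _ = refl
  braid₁₂-fixes {suc (suc zero)} {suc (suc (suc q))} _ _ _ = refl
  braid₁₂-fixes {suc (suc (suc p))} {suc (suc zero)} (valid (s≤s (s≤s ())) _ _)
  braid₁₂-fixes {suc (suc (suc zero))} {suc (suc (suc q))} _ _ _ = refl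
  braid₁₂-fixes {suc (suc (suc (suc p)))} {suc (suc (suc zero))} (valid (s≤s (s≤s (s≤s ()))) _ _)
  braid₁₂-fixes {suc (suc (suc (suc p)))} {suc (suc (suc (suc q)))} _ _ _ = refl

  private
    pair : State c → ℕ × ℕ
    pair s = State.p s , State.q s

    pair-injective : ∀ {s t} → pair s ≡ pair t → s ≡ t
    pair-injective eq = state-≡ (cong proj₁ eq) (cong proj₂ eq)

  transposition-by-word : ∀ w t → moves w (0 , 1) ≡ pair t → moves w (pair t) ≡ (0 , 1) →
    (∀ {p q} → Valid c p q → (p , q) ≢ (0 , 1) → (p , q) ≢ pair t → moves w (p , q) ≡ (p , q)) →
    Realizable (Transposition.transpose _≟ₛ_ base t)
  transposition-by-word w t to-t to-base fixes = w , λ s → by-view (transpose-view base t s)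
    where
    open Transposition _≟ₛ_
    by-view : ∀ {s u} → TransposeView base t s u → act w s ≡ u
    by-view (at-left refl)      = pair-injective (trans (act-moves w base) to-t)
    by-view (at-right _ refl)   = pair-injective (trans (act-moves w t) to-base)
    by-view {s} (elsewhere s≢base s≢t) = pair-injective (trans (act-moves w s)
      (fixes (State.isValid s) (s≢base ∘ pair-injective) (s≢t ∘ pair-injective)))

  at-base : ∀ i → generator i base ≡ base ⊎ Realizable (Transposition.transpose _≟ₛ_ base (generator i base))
  at-base fzero                  = inj₂ (transposition-by-word braid₀₁ _ refl refl braid₀₁-fixes)
  at-base (fsuc fzero)           = inj₁ (pair-injective refl)
  at-base (fsuc (fsuc fzero))    = inj₂ (transposition-by-word braid₁₂ _ refl refl braid₁₂-fixes)
  at-base (fsuc (fsuc (fsuc i))) = inj₁ (pair-injective refl)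

  LESymmetric₁₁ : LESymmetric 1 1 c
  LESymmetric₁₁ = LESymmetric-from-model _≟ₛ_ generator linear-extensions↔states bk-encode
    (realizable-injection (λ i → moveState-involutive (toℕ i)) base connected at-base (states c) ∈-states)

proposition4p16 : ((c : ℕ) → 1 ≤ c → LESymmetric 1 1 c) × ((a : ℕ) → 1 ≤ a → LESymmetric a 1 1)
proposition4p16 = N₁₁ , (λ a 1≤a → LESymmetric-mirror {1} {1} {a} ≤-refl (N₁₁ a 1≤a))
  where
  N₁₁ : (c : ℕ) → 1 ≤ c → LESymmetric 1 1 c
  N₁₁ (suc c′) _ = Generation₁₁.LESymmetric₁₁ c′
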